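{- Let $F \in \mathrm{SMU}_{\delta=1}$ and let $T$ be its tree representation. Then: (1) For every clause-set $F'$ equivalent to $D(F)$ there is an injection $i: D(F)\to F'$ with $C \subseteq i(C)$ for all $C\in D(F)$. (2) $D(F)$ is a total mps. (3) $\mathrm{prc}_0(D(F)) = \{C_V : \emptyset \ne V \subseteq \mathrm{lvs}(T)\}$, where for $\emptyset\ne V\subseteq \mathrm{lvs}(T)$ we have $C_V = U_V \cup P_V$ with $U_V\cap P_V=\emptyset$, $U_V = \{u_w : w\in V\}$, and $P_V$ the set of literals $x$ such that $V\cap\mathrm{lvs}(T_x)\neq\emptyset$ and $V\cap\mathrm{lvs}(T_{\overline{x}})=\emptyset$. (4) $\mathrm{hd}(D(F)) = \mathrm{hts}(T)$.
   Context: Clauses are finite sets of literals without complementary pair; clause-sets finite sets of clauses; $\top$ empty clause-set, $\bot$ empty clause. $\mathrm{prc}_0(G)$: prime implicates (inclusion-minimal clauses implied by $G$); clause-sets are equivalent iff they have the same prime implicates. $\mathrm{SMU}_{\delta=1}$: saturated minimally unsatisfiable clause-sets of deficiency $1$ (unsatisfiable, every proper subset satisfiable, adding any literal on a new variable to any clause yields a satisfiable clause-set, and number of clauses minus number of variables equals $1$). Every $F\in\mathrm{SMU}_{\delta=1}$ has a unique tree representation: a full binary tree $T$ whose inner nodes are labelled injectively by variables, where the edge from an inner node labelled $v$ to its left child is labelled $v$ and to its right child $\overline{v}$, such that $F = \{C_w : w \in \mathrm{lvs}(T)\}$, $C_w$ being the set of edge labels on the path from the root to leaf $w$ ($\mathrm{lvs}(T)$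 = set of leaves). For a literal $x$ over $\mathrm{var}(F)$, with $w$ the node labelled $\mathrm{var}(x)$, $T_x$ is the subtree of $w$ reached via the edge labelled $x$. Doping: each $C\in F$ gets a distinct new variable $u_C\notin\mathrm{var}(F)$; $D(F) := \{C\cup\{u_C\}: C\in F\}$; $u_w := u_{C_w}$. For $\emptyset\ne V\subseteq\mathrm{lvs}(T)$, $C_V := \mathrm{pure}(\{C_w\cup\{u_w\} : w\in V\})$, where $\mathrm{pure}(G)$ is the set of literals occurring in $G$ whose complement does not occur in $G$. Mps: $G$ is a minimal premise set for $C$ if $G\models C$ and no proper subset implies $C$; a total mps is a clause-set $G\neq\top$ all of whose nonempty subsets are minimal premise sets (for some clause). Horton–Strahler number $\mathrm{hts}$: $0$ for the one-node tree; for subtrees $T_1,T_2$, $1+\mathrm{hts}(T_1)$ if $\mathrm{hts}(T_1)=\mathrm{hts}(T_2)$, else the maximum. Hardness $\mathrm{hd}(G)$: for unsatisfiable $G$ the minimum $\mathrm{hts}$ of a resolution tree deriving $\bot$ from $G$; $\mathrm{hd}(\top)=0$; for satisfiable $G\neq\top$ the maximum of $\mathrm{hd}(\varphi*G)$ over partial assignments $\varphi$ with $\varphi*G$ unsatisfiable ($\varphi * G$ removes satisfied clauses and falsified literals). -}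

module Defs where

open import Data.Nat using (ℕ; zero; suc; _≤_; _⊔_; _≟_; _≡ᵇ_)

open import Data.Bool using (Bool; true; false; not; _xor_; if_then_else_)
open import Data.Maybe using (Maybe; just; nothing)
open import Data.List using (List; []; _∷_; map; concatMap; filterᵇ; length; deduplicate)
open import Data.Bool.ListAction using (any)
open import Data.List.Relation.Unary.All using (All)
open import Data.List.Relation.Unary.Any using (Any; _─_)
open import Data.List.Relation.Unary.AllPairs using (AllPairs)
open import Data.List.Membership.Propositional using (_∈_; _∉_)
open import Data.Product using (Σ; ∃; _×_; _,_)
open import Data.Sum using (_⊎_)
open import Data.Empty using (⊥)
open import Relation.Nullary using (¬_)
open import Relation.Binary.PropositionalEquality using (_≡_; _≢_)

_⇔′_ : Set → Set → Set
A ⇔′ B = (A → B) × (B → A)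

-- Literals, clauses, clause-sets
-- Variables are natural numbers; a literal is a variable with a polarity
-- (true = positive literal v, false = negative literal v̄).

record Lit : Set where
  constructor lit
  field
    var : ℕ
    pol : Bool
open Lit public

pos : ℕ → Lit
pos v = lit v true

compl : Lit → Lit
compl (lit v b) = lit v (not b)

-- A clause is represented by a list of literals, read as the *set* of its
-- elements (duplicates/order irrelevant).
Clause : Set
Clause = List Lit

_∈ᶜ_ : Lit → Clause → Set
x ∈ᶜ C = x ∈ C

IsClause : Clause → Set
IsClause C = ∀ x → x ∈ C → ¬ (compl x ∈ C)

_⊆ᶜ_ : Clause → Clause → Set
C ⊆ᶜ D = ∀ x → x ∈ C → x ∈ D

_≈ᶜ_ : Clause → Clause → Set
C ≈ᶜ D = ∀ x → (x ∈ C) ⇔′ (x ∈ D)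

-- A clause-set is represented by a list of clauses, read as the set of its
-- elements (up to ≈ᶜ).
ClauseList : Set
ClauseList = List Clause

_∈ₛ_ : Clause → ClauseList → Set
C ∈ₛ F = Any (λ D → C ≈ᶜ D) F

_∉ₛ_ : Clause → ClauseList → Set
C ∉ₛ F = ¬ (C ∈ₛ F)

_⊆ₛ_ : ClauseList → ClauseList → Set
G ⊆ₛ F = ∀ C → C ∈ₛ G → C ∈ₛ F

_⊂ₛ_ : ClauseList → ClauseList → Set
G ⊂ₛ F = G ⊆ₛ F × Σ Clause (λ C → C ∈ₛ F × C ∉ₛ G)

-- well-formed list representation of a clause-set: every element is a
-- clause and no clause is listed twice (so the length is the cardinality)
IsClauseSet : ClauseList → Set
IsClauseSet F = All IsClause F × AllPairs (λ C D → ¬ (C ≈ᶜ D)) F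

vars : ClauseList → List ℕ
vars F = concatMap (map var) F

nVars : ClauseList → ℕ
nVars F = length (deduplicate _≟_ (vars F))

Assignment : Set
Assignment = ℕ → Bool

SatLit : Assignment → Lit → Set
SatLit α x = α (var x) ≡ pol x

SatClause : Assignment → Clause → Set
SatClause α C = Any (SatLit α) C

SatCS : Assignment → ClauseList → Set
SatCS α F = All (SatClause α) F

Satisfiable : ClauseList → Set
Satisfiable F = Σ Assignment (λ α → SatCS α F)

Unsat : ClauseList → Set
Unsat F = ¬ Satisfiable F

_⊨_ : ClauseList → Clause → Set
G ⊨ C = ∀ (α : Assignment) → SatCS α G → SatClause α C

PrimeImp : ClauseList → Clause → Set
PrimeImp G C = IsClause C × G ⊨ C × (∀ C′ → C′ ⊆ᶜ C → G ⊨ C′ → C ⊆ᶜ C′)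

Equivalent : ClauseList → ClauseList → Set
Equivalent G G′ = ∀ C → PrimeImp G C ⇔′ PrimeImp G′ C

MU : ClauseList → Set
MU F = Unsat F × (∀ G → G ⊂ₛ F → Satisfiable G)

Saturated : ClauseList → Set
Saturated F = ∀ C (p : C ∈ F) (x : Lit) → var x ∉ map var C →
  Satisfiable ((x ∷ C) ∷ (F ─ p))

SMU1 : ClauseList → Set
SMU1 F = IsClauseSet F × MU F × Saturated F × length F ≡ suc (nVars F)

data Tree : Set where
  leaf : Tree
  node : ℕ → Tree → Tree → Tree

labels : Tree → List ℕ
labels leaf = []
labels (node v l r) = v ∷ (labels l Data.List.++ labels r)

count : ℕ → List ℕ → ℕ
count n [] = 0
count n (m ∷ ms) = if n ≡ᵇ m then suc (count n ms) else count n ms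

InjLabels : Tree → Set
InjLabels T = ∀ v → count v (labels T) ≤ 1

-- nodes are addressed by paths from the root: true = left child (edge
-- labelled v), false = right child (edge labelled v̄)
Path : Set
Path = List Bool

data IsLeaf : Tree → Path → Set where
  lf  : IsLeaf leaf []
  goL : ∀ {v l r w} → IsLeaf l w → IsLeaf (node v l r) (true ∷ w)
  goR : ∀ {v l r w} → IsLeaf r w → IsLeaf (node v l r) (false ∷ w)

clauseOf : Tree → Path → Clause
clauseOf (node v l r) (true ∷ w)  = lit v true  ∷ clauseOf l w
clauseOf (node v l r) (false ∷ w) = lit v false ∷ clauseOf r w
clauseOf _ _ = []

TreeRep : Tree → ClauseList → Set
TreeRep T F = InjLabels T ×
  (∀ C → (C ∈ₛ F) ⇔′ Σ Path (λ w → IsLeaf T w × C ≈ᶜ clauseOf T w))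

-- Through T x w : the path w passes through the edge labelled x, i.e.
-- (for a leaf w) w ∈ lvs(T_x)
Through : Tree → Lit → Path → Set
Through (node v l r) x (true ∷ w)  = (v ≡ var x × true ≡ pol x) ⊎ Through l x w
Through (node v l r) x (false ∷ w) = (v ≡ var x × false ≡ pol x) ⊎ Through r x w
Through _ _ _ = ⊥

hcomb : ℕ → ℕ → ℕ
hcomb a b = if a ≡ᵇ b then suc a else a ⊔ b

hts : Tree → ℕ
hts leaf = 0
hts (node v l r) = hcomb (hts l) (hts r)

Doping : ClauseList → (Clause → ℕ) → Set
Doping F u =
  (∀ C C′ → C ∈ₛ F → C′ ∈ₛ F → C ≈ᶜ C′ → u C ≡ u C′) ×   -- well-defined on sets
  (∀ C C′ → C ∈ₛ F → C′ ∈ₛ F → u C ≡ u C′ → C ≈ᶜ C′) ×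
  (∀ C → C ∈ₛ F → u C ∉ vars F)

D : ClauseList → (Clause → ℕ) → ClauseList
D F u = map (λ C → pos (u C) ∷ C) F

uLeaf : Tree → (Clause → ℕ) → Path → ℕ
uLeaf T u w = u (clauseOf T w)

LeafSubset : Tree → List Path → Set
LeafSubset T V = V ≢ [] × All (IsLeaf T) V

OccV : Tree → (Clause → ℕ) → List Path → Lit → Set
OccV T u V x = Σ Path (λ w → w ∈ V × (x ∈ clauseOf T w ⊎ x ≡ pos (uLeaf T u w)))

-- x ∈ C_V = pure({C_w ∪ {u_w} : w ∈ V})
InCV : Tree → (Clause → ℕ) → List Path → Lit → Set
InCV T u V x = OccV T u V x × ¬ OccV T u V (compl x)

InUV : Tree → (Clause → ℕ) → List Path → Lit → Set
InUV T u V x = Σ Path (λ w → w ∈ V × x ≡ pos (uLeaf T u w))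

InPV : Tree → List Path → Lit → Set
InPV T V x = Σ Path (λ w → w ∈ V × Through T x w)
           × ¬ Σ Path (λ w → w ∈ V × Through T (compl x) w)

MinPremise : ClauseList → Clause → Set
MinPremise G C = IsClause C × G ⊨ C × (∀ H → H ⊂ₛ G → ¬ (H ⊨ C))

TotalMps : ClauseList → Set
TotalMps G = G ≢ [] × (∀ H → H ⊆ₛ G → H ≢ [] → Σ Clause (λ C → MinPremise H C))

data Res (G : ClauseList) : Clause → Set where
  axiom   : ∀ {C} → C ∈ₛ G → Res G C
  resolve : ∀ {C C′ E} (x : Lit) → Res G C → Res G C′ → x ∈ C → compl x ∈ C′ →
            IsClause E →
            (∀ y → (y ∈ E) ⇔′ ((y ∈ C × y ≢ x) ⊎ (y ∈ C′ × y ≢ compl x))) →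
            Res G E

htsR : ∀ {G C} → Res G C → ℕ
htsR (axiom _) = 0
htsR (resolve _ d e _ _ _ _) = hcomb (htsR d) (htsR e)

EmptyClause : Clause → Set
EmptyClause C = ∀ x → x ∉ C

HdUnsat : ClauseList → ℕ → Set
HdUnsat G k =
  Σ Clause (λ C → Σ (Res G C) (λ d → EmptyClause C × htsR d ≡ k)) ×
  (∀ C (d : Res G C) → EmptyClause C → k ≤ htsR d)

PAssignment : Set
PAssignment = ℕ → Maybe Bool

litTrue : PAssignment → Lit → Bool
litTrue φ x with φ (var x)
... | just b  = not (b xor pol x)
... | nothing = false

litFalse : PAssignment → Lit → Bool
litFalse φ x with φ (var x)
... | just b  = b xor pol x
... | nothing = false

_*ₚ_ : PAssignment → ClauseList → ClauseList
φ *ₚ G = map (filterᵇ (λ x → not (litFalse φ x)))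
             (filterᵇ (λ C → not (any (litTrue φ) C)) G)

Hd : ClauseList → ℕ → Set
Hd G k =
  (G ≡ [] × k ≡ 0) ⊎
  (Unsat G × HdUnsat G k) ⊎
  (G ≢ [] × Satisfiable G ×
    Σ PAssignment (λ φ → Unsat (φ *ₚ G) × HdUnsat (φ *ₚ G) k) ×
    (∀ φ k′ → Unsat (φ *ₚ G) → HdUnsat (φ *ₚ G) k′ → k′ ≤ k))

module Submission where

-- Everything is read off the tree T.  Each assignment falsifies exactly one leaf clause C_w,
-- so D(F) ⊨ X iff at every leaf w either u_w ∈ X or C_w clashes with X ("X covers w").
-- A prime implicate C is then C_V for V the leaves w with u_w ∈ C: removing any literal of C
-- uncovers some leaf, and that leaf shows the literal to be pure in {C_w ∪ {u_w} : w ∈ V}.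
-- A nonempty H ⊆ D(F) is a minimal premise set for C_V with V the leaves of H, since omitting
-- the clause of a leaf w₀ lets C_w₀ and C_V be falsified together.  In a clause-set F′
-- equivalent to D(F), each doped clause C is contained in any clause of F′ falsified by the
-- assignment falsifying C and setting everything else true.  For hardness, setting all u_w
-- to false leaves F, whose refutations have Horton–Strahler number at least hts T (induct
-- over the refutation, tracking the part of T that a partial assignment leaves unsatisfied),
-- while every unsatisfiable restriction of D(F) is refuted along T within that bound.

open import Defs
open import Data.Nat using (ℕ; zero; suc; _≤_; _<_; _⊔_; _≡ᵇ_; z≤n; s≤s; s≤s⁻¹; _+_)
import Data.Nat.Properties as ℕ
open import Data.Bool using (Bool; true; false; not; _xor_; if_then_else_; T)
import Data.Bool.Properties as Bool
open import Data.Maybe using (Maybe; just; nothing; fromMaybe)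
open import Data.Bool.ListAction using (any)
open import Data.List using (List; []; _∷_; _++_; map; filter; filterᵇ; length; concatMap; head)
open import Data.List.Properties using (++-identityʳ; ≡-dec; filter-notAll; filter-≐)
open import Data.List.Relation.Unary.Any using (Any; here; there; any?)
open import Data.List.Relation.Unary.All as All using (All; []; _∷_)
open import Data.List.Relation.Unary.All.Properties using (¬All⇒Any¬)
open import Data.List.Membership.Propositional using (_∈_; _∉_; find; lose)
open import Data.List.Membership.Propositional.Properties
  using (∈-++⁺ˡ; ∈-++⁺ʳ; ∈-++⁻; ∈-map⁺; ∈-map⁻; ∈-filter⁺; ∈-filter⁻; ∈-concatMap⁺; ∈-concatMap⁻)
import Data.List.Membership.DecPropositional as DecMembership
open import Data.Product using (Σ; _×_; _,_; proj₁; proj₂)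
open import Data.Sum using (_⊎_; inj₁; inj₂; [_,_]) renaming (map to ⊎-map)
open import Function using (_∘_; id; case_of_)
open import Relation.Nullary using (¬_; Dec; yes; no; does; ¬?; _⊎-dec_)
open import Relation.Nullary.Decidable using (map′; T?)
open import Relation.Nullary.Negation using (contradiction)
open import Relation.Binary.Definitions using (DecidableEquality; tri<; tri≈; tri>)
open import Relation.Binary.PropositionalEquality
  using (_≡_; _≢_; refl; sym; trans; cong; cong₂; subst; ≢-sym)
open import Data.List.Relation.Binary.Permutation.Propositional using (_↭_; ↭-sym)
open import Data.List.Relation.Binary.Permutation.Propositional.Properties using (∈-resp-↭; shift)

≡ᵇ-refl : ∀ n → (n ≡ᵇ n) ≡ true
≡ᵇ-refl n with n ≡ᵇ n in eq
... | true  = refl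
... | false = contradiction (subst T eq (ℕ.≡⇒≡ᵇ n n refl)) λ ()

≢⇒≡ᵇ-false : ∀ {m n} → m ≢ n → (m ≡ᵇ n) ≡ false
≢⇒≡ᵇ-false {m} {n} m≢n with m ≡ᵇ n in eq
... | true  = contradiction (ℕ.≡ᵇ⇒≡ m n (subst T (sym eq) _)) m≢n
... | false = refl

_≟ˡ_ : DecidableEquality Lit
lit v b ≟ˡ lit w c with v ℕ.≟ w | b Bool.≟ c
... | yes refl | yes refl = yes refl
... | no v≢w   | _        = no λ { refl → v≢w refl }
... | yes _    | no b≢c   = no λ { refl → b≢c refl }

_≟ᵖ_ : DecidableEquality Path
_≟ᵖ_ = ≡-dec Bool._≟_

open DecMembership _≟ˡ_ using () renaming (_∈?_ to _∈ˡ?_)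
open DecMembership _≟ᵖ_ using () renaming (_∈?_ to _∈ᵖ?_)
open DecMembership ℕ._≟_ using () renaming (_∈?_ to _∈ⁿ?_)

compl-involutive : ∀ x → compl (compl x) ≡ x
compl-involutive (lit v b) = cong (lit v) (Bool.not-involutive b)

compl-injective : ∀ {x y} → compl x ≡ compl y → x ≡ y
compl-injective {x} {y} eq =
  trans (sym (compl-involutive x)) (trans (cong compl eq) (compl-involutive y))

var-compl : ∀ x → var (compl x) ≡ var x
var-compl (lit v b) = refl

compl-≢ : ∀ x → compl x ≢ x
compl-≢ (lit v b) eq = Bool.not-¬ refl (sym (cong pol eq))

sameVar⇒≡⊎compl : ∀ {x y} → var x ≡ var y → x ≡ y ⊎ y ≡ compl x
sameVar⇒≡⊎compl {lit v b} {lit .v c} refl with b Bool.≟ c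
... | yes refl = inj₁ refl
... | no b≢c   = inj₂ (cong (lit v) (Bool.¬-not (≢-sym b≢c)))

¬SatLit⇒SatLit-compl : ∀ {α x} → ¬ SatLit α x → SatLit α (compl x)
¬SatLit⇒SatLit-compl {x = lit v b} = Bool.¬-not

SatLit-compl⇒¬SatLit : ∀ {α x} → SatLit α (compl x) → ¬ SatLit α x
SatLit-compl⇒¬SatLit {x = lit v b} s s′ = Bool.not-¬ s′ s

¬SatLit-compl⇒SatLit : ∀ {α x} → ¬ SatLit α (compl x) → SatLit α x
¬SatLit-compl⇒SatLit {α} {x} n =
  subst (SatLit α) (compl-involutive x) (¬SatLit⇒SatLit-compl {α} {compl x} n)

SatLit? : ∀ α x → Dec (SatLit α x)
SatLit? α x = α (var x) Bool.≟ pol x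

Falsifies : Assignment → Clause → Set
Falsifies α C = ∀ y → y ∈ C → ¬ SatLit α y

Falsifies-compl : ∀ {α L z} → Falsifies α L → compl z ∈ L → SatLit α z
Falsifies-compl {α} {L} {z} f cz∈ = ¬SatLit-compl⇒SatLit {α} {z} (f (compl z) cz∈)

Falsifies⇒¬SatClause : ∀ {α C} → Falsifies α C → ¬ SatClause α C
Falsifies⇒¬SatClause f s with find s
... | y , y∈C , sy = f y y∈C sy

flipTo : Assignment → Lit → Assignment
flipTo α x n = if n ≡ᵇ var x then pol x else α n

flipTo-sat : ∀ α x → SatLit (flipTo α x) x
flipTo-sat α x rewrite ≡ᵇ-refl (var x) = refl

flipTo-other : ∀ α x n → n ≢ var x → flipTo α x n ≡ α n
flipTo-other α x n ne rewrite ≢⇒≡ᵇ-false ne = refl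

flipTo-preserves : ∀ α x {z} → SatLit α z → z ≢ compl x → SatLit (flipTo α x) z
flipTo-preserves α x {z} sz z≢cx with var z ℕ.≟ var x
... | no z≢x = trans (flipTo-other α x (var z) z≢x) sz
... | yes e with sameVar⇒≡⊎compl {z} {x} e
...   | inj₁ refl = flipTo-sat α x
...   | inj₂ x≡cz = contradiction (trans (sym (compl-involutive z)) (cong compl (sym x≡cz))) z≢cx

≈ᶜ-refl : ∀ {C} → C ≈ᶜ C
≈ᶜ-refl x = (λ m → m) , (λ m → m)

≈ᶜ-sym : ∀ {C C′} → C ≈ᶜ C′ → C′ ≈ᶜ C
≈ᶜ-sym e x = proj₂ (e x) , proj₁ (e x)

≈ᶜ-trans : ∀ {C C′ C″} → C ≈ᶜ C′ → C′ ≈ᶜ C″ → C ≈ᶜ C″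
≈ᶜ-trans e f x = proj₁ (f x) ∘ proj₁ (e x) , proj₂ (e x) ∘ proj₂ (f x)

≈ᶜ⇒⊆ᶜ : ∀ {C C′} → C ≈ᶜ C′ → C ⊆ᶜ C′
≈ᶜ⇒⊆ᶜ e x = proj₁ (e x)

∷-cong-≈ᶜ : ∀ x {C C′} → C ≈ᶜ C′ → (x ∷ C) ≈ᶜ (x ∷ C′)
∷-cong-≈ᶜ x e y = (λ { (here p) → here p ; (there m) → there (proj₁ (e y) m) })
                , (λ { (here p) → here p ; (there m) → there (proj₂ (e y) m) })

↭⇒≈ᶜ : ∀ {C C′} → C ↭ C′ → C ≈ᶜ C′
↭⇒≈ᶜ C↭C′ x = ∈-resp-↭ C↭C′ , ∈-resp-↭ (↭-sym C↭C′)

∈ₛ-resp-≈ᶜ : ∀ {C C′ G} → C ≈ᶜ C′ → C ∈ₛ G → C′ ∈ₛ G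
∈ₛ-resp-≈ᶜ e (here p)  = here (≈ᶜ-trans (≈ᶜ-sym e) p)
∈ₛ-resp-≈ᶜ e (there p) = there (∈ₛ-resp-≈ᶜ e p)

∈⇒∈ₛ : ∀ {C G} → C ∈ G → C ∈ₛ G
∈⇒∈ₛ C∈G = lose C∈G ≈ᶜ-refl

SatClause-⊆ᶜ : ∀ {α C C′} → C ⊆ᶜ C′ → SatClause α C → SatClause α C′
SatClause-⊆ᶜ C⊆C′ s with find s
... | y , y∈C , sy = lose (C⊆C′ y y∈C) sy

SatClause-≈ᶜ : ∀ {α C C′} → C ≈ᶜ C′ → SatClause α C → SatClause α C′
SatClause-≈ᶜ = SatClause-⊆ᶜ ∘ ≈ᶜ⇒⊆ᶜ

SatCS-∈ₛ : ∀ {α G C} → SatCS α G → C ∈ₛ G → SatClause α C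
SatCS-∈ₛ s C∈G with find C∈G
... | C′ , C′∈G , C≈C′ = SatClause-≈ᶜ (≈ᶜ-sym C≈C′) (All.lookup s C′∈G)

∈⇒⊨ : ∀ {G C} → C ∈ G → G ⊨ C
∈⇒⊨ C∈G α s = All.lookup s C∈G

⊨-weaken : ∀ {G C C′} → C ⊆ᶜ C′ → G ⊨ C → G ⊨ C′
⊨-weaken C⊆C′ G⊨C α s = SatClause-⊆ᶜ C⊆C′ (G⊨C α s)

IsClause-⊆ᶜ : ∀ {C C′} → C′ ⊆ᶜ C → IsClause C → IsClause C′
IsClause-⊆ᶜ C′⊆C isC x m cm = isC x (C′⊆C x m) (C′⊆C (compl x) cm)

IsClause-≈ᶜ : ∀ {C C′} → C ≈ᶜ C′ → IsClause C → IsClause C′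
IsClause-≈ᶜ = IsClause-⊆ᶜ ∘ ≈ᶜ⇒⊆ᶜ ∘ ≈ᶜ-sym

IsClause-++ : ∀ {A C} → IsClause A → IsClause C → (∀ y → y ∈ A → compl y ∉ C) →
  IsClause (A ++ C)
IsClause-++ {A} {C} isA isC noClash x m cm with ∈-++⁻ A m | ∈-++⁻ A cm
... | inj₁ a | inj₁ b = isA x a b
... | inj₂ a | inj₂ b = isC x a b
... | inj₁ a | inj₂ b = noClash x a b
... | inj₂ a | inj₁ b = noClash (compl x) b (subst (_∈ C) (sym (compl-involutive x)) a)

IsClause-∷ : ∀ {x C} → IsClause C → compl x ∉ C → IsClause (x ∷ C)
IsClause-∷ isC cx∉C y (here refl) (here e) = compl-≢ y e
IsClause-∷ isC cx∉C y (here refl) (there m) = cx∉C m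
IsClause-∷ isC cx∉C y (there m) (here e) =
  cx∉C (subst (_∈ _) (trans (sym (compl-involutive y)) (cong compl e)) m)
IsClause-∷ isC cx∉C y (there m) (there m′) = isC y m m′

remove : Lit → Clause → Clause
remove x = filter (λ y → ¬? (y ≟ˡ x))

∈-remove⁻ : ∀ {x y} C → y ∈ remove x C → y ∈ C × y ≢ x
∈-remove⁻ C = ∈-filter⁻ (λ y → ¬? (y ≟ˡ _))

∈-remove⁺ : ∀ {x y} C → y ∈ C → y ≢ x → y ∈ remove x C
∈-remove⁺ C = ∈-filter⁺ (λ y → ¬? (y ≟ˡ _))

remove-⊆ᶜ : ∀ x C → remove x C ⊆ᶜ C
remove-⊆ᶜ x C y = proj₁ ∘ ∈-remove⁻ C

length-remove : ∀ {x} C → x ∈ C → length (remove x C) < length C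
length-remove C x∈C = filter-notAll (λ y → ¬? (y ≟ˡ _)) C (lose x∈C λ x≢x → x≢x refl)

falsifier : Clause → Assignment
falsifier [] n = true
falsifier (x ∷ L) n = if var x ≡ᵇ n then not (pol x) else falsifier L n

falsifier-value : ∀ L y → IsClause L → y ∈ L → falsifier L (var y) ≡ not (pol y)
falsifier-value (x ∷ L) y isL y∈L with var x ℕ.≟ var y
... | yes e rewrite e | ≡ᵇ-refl (var y) with sameVar⇒≡⊎compl e
...   | inj₁ x≡y = cong (not ∘ pol) x≡y
...   | inj₂ y≡cx = contradiction (subst (_∈ (x ∷ L)) y≡cx y∈L) (isL x (here refl))
falsifier-value (x ∷ L) y isL (here refl) | no ne = contradiction refl ne
falsifier-value (x ∷ L) y isL (there y∈L) | no ne rewrite ≢⇒≡ᵇ-false ne =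
  falsifier-value L y (IsClause-⊆ᶜ (λ _ → there) isL) y∈L

falsifier-falsifies : ∀ L → IsClause L → Falsifies (falsifier L) L
falsifier-falsifies L isL y y∈L s = Bool.not-¬ refl (trans (sym s) (falsifier-value L y isL y∈L))

falsifier-outside : ∀ L n → (∀ y → y ∈ L → var y ≢ n) → falsifier L n ≡ true
falsifier-outside [] n _ = refl
falsifier-outside (x ∷ L) n fresh rewrite ≢⇒≡ᵇ-false (fresh x (here refl)) =
  falsifier-outside L n (λ y → fresh y ∘ there)

falsifier-≈ᶜ : ∀ {C C′} → IsClause C → IsClause C′ → C ≈ᶜ C′ → ∀ n →
  falsifier C n ≡ falsifier C′ n
falsifier-≈ᶜ {C} {C′} isC isC′ e n with any? (λ y → var y ℕ.≟ n) C
... | yes occ with find occ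
...   | y , y∈C , refl = trans (falsifier-value C y isC y∈C)
                               (sym (falsifier-value C′ y isC′ (proj₁ (e y) y∈C)))
falsifier-≈ᶜ {C} {C′} isC isC′ e n | no ¬occ =
  trans (falsifier-outside C n (λ y y∈C eq → ¬occ (lose y∈C eq)))
        (sym (falsifier-outside C′ n (λ y y∈C′ eq → ¬occ (lose (proj₂ (e y) y∈C′) eq))))

hcomb-same : ∀ a → hcomb a a ≡ suc a
hcomb-same a rewrite ≡ᵇ-refl a = refl

hcomb-distinct : ∀ {a b} → a ≢ b → hcomb a b ≡ a ⊔ b
hcomb-distinct a≢b rewrite ≢⇒≡ᵇ-false a≢b = refl

hcomb≤⇒ : ∀ {a b h} → hcomb a b ≤ h → a ≤ h × b ≤ h × (a < h ⊎ b < h)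
hcomb≤⇒ {a} {b} {h} le with a ℕ.≟ b
... | yes refl rewrite hcomb-same a = ℕ.<⇒≤ le , ℕ.<⇒≤ le , inj₁ le
... | no a≢b rewrite hcomb-distinct a≢b = a≤h , b≤h , one<
  where
  a≤h = ℕ.m⊔n≤o⇒m≤o a b le
  b≤h = ℕ.m⊔n≤o⇒n≤o a b le
  one< : a < h ⊎ b < h
  one< with ℕ.<-cmp a b
  ... | tri< a<b _ _ = inj₁ (ℕ.<-≤-trans a<b b≤h)
  ... | tri≈ _ a≡b _ = contradiction a≡b a≢b
  ... | tri> _ _ b<a = inj₂ (ℕ.<-≤-trans b<a a≤h)

⇒hcomb≤ : ∀ {a b h} → a ≤ h → b ≤ h → (a < h ⊎ b < h) → hcomb a b ≤ h
⇒hcomb≤ {a} {b} a≤h b≤h one< with a ℕ.≟ b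
... | yes refl rewrite hcomb-same a = [ id , id ] one<
... | no a≢b rewrite hcomb-distinct a≢b = ℕ.⊔-lub a≤h b≤h

m≤hcomb : ∀ a b → a ≤ hcomb a b
m≤hcomb a b = proj₁ (hcomb≤⇒ {a} {b} ℕ.≤-refl)

n≤hcomb : ∀ a b → b ≤ hcomb a b
n≤hcomb a b = proj₁ (proj₂ (hcomb≤⇒ {a} {b} ℕ.≤-refl))

hcomb-mono-≤ : ∀ {a a′ b b′} → a ≤ a′ → b ≤ b′ → hcomb a b ≤ hcomb a′ b′
hcomb-mono-≤ {a} {a′} {b} {b′} a≤a′ b≤b′ with hcomb≤⇒ {a′} {b′} ℕ.≤-refl
... | p , q , inj₁ r = ⇒hcomb≤ (ℕ.≤-trans a≤a′ p) (ℕ.≤-trans b≤b′ q) (inj₁ (ℕ.≤-<-trans a≤a′ r))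
... | p , q , inj₂ r = ⇒hcomb≤ (ℕ.≤-trans a≤a′ p) (ℕ.≤-trans b≤b′ q) (inj₂ (ℕ.≤-<-trans b≤b′ r))

hcomb-comm : ∀ a b → hcomb a b ≡ hcomb b a
hcomb-comm a b with a ℕ.≟ b
... | yes refl = refl
... | no a≢b = trans (hcomb-distinct a≢b) (trans (ℕ.⊔-comm a b) (sym (hcomb-distinct (≢-sym a≢b))))

hcomb-distribʳ-≤ : ∀ a₀ a₁ b → hcomb (hcomb a₀ a₁) b ≤ hcomb (hcomb a₀ b) (hcomb a₁ b)
hcomb-distribʳ-≤ a₀ a₁ b with hcomb≤⇒ {hcomb a₀ b} {hcomb a₁ b} ℕ.≤-refl
... | p , q , r = ⇒hcomb≤ (⇒hcomb≤ a₀≤ a₁≤ (⊎-map a₀< a₁< r)) b≤ (inj₂ b<)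
  where
  a₀≤ = ℕ.≤-trans (m≤hcomb a₀ b) p
  a₁≤ = ℕ.≤-trans (m≤hcomb a₁ b) q
  b≤  = ℕ.≤-trans (n≤hcomb a₀ b) p
  a₀< = ℕ.≤-<-trans (m≤hcomb a₀ b)
  a₁< = ℕ.≤-<-trans (m≤hcomb a₁ b)
  b<  = [ ℕ.≤-<-trans (n≤hcomb a₀ b) , ℕ.≤-<-trans (n≤hcomb a₁ b) ] r

hcomb-distribˡ-≤ : ∀ a b₀ b₁ → hcomb a (hcomb b₀ b₁) ≤ hcomb (hcomb a b₀) (hcomb a b₁)
hcomb-distribˡ-≤ a b₀ b₁ rewrite hcomb-comm a (hcomb b₀ b₁) | hcomb-comm a b₀ | hcomb-comm a b₁ =
  hcomb-distribʳ-≤ b₀ b₁ a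

branch : Bool → Tree → Tree → Tree
branch true  l r = l
branch false l r = r

count-++ : ∀ v xs ys → count v (xs ++ ys) ≡ count v xs + count v ys
count-++ v [] ys = refl
count-++ v (m ∷ xs) ys with v ≡ᵇ m
... | true  = cong suc (count-++ v xs ys)
... | false = count-++ v xs ys

∈⇒1≤count : ∀ {v xs} → v ∈ xs → 1 ≤ count v xs
∈⇒1≤count {v} (here refl) rewrite ≡ᵇ-refl v = s≤s z≤n
∈⇒1≤count {v} {m ∷ _} (there v∈xs) with v ≡ᵇ m
... | true  = s≤s z≤n
... | false = ∈⇒1≤count v∈xs

count-subtrees≤ : ∀ n v l r → count n (labels l ++ labels r) ≤ count n (labels (node v l r))
count-subtrees≤ n v l r with n ≡ᵇ v
... | true  = ℕ.n≤1+n _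
... | false = ℕ.≤-refl

module _ (v : ℕ) (l r : Tree) (inj : InjLabels (node v l r)) where

  private
    count-subtrees≤1 : ∀ n → count n (labels l) + count n (labels r) ≤ 1
    count-subtrees≤1 n = ℕ.≤-trans (ℕ.≤-reflexive (sym (count-++ n (labels l) (labels r))))
                                    (ℕ.≤-trans (count-subtrees≤ n v l r) (inj n))

    count-branch≤ : ∀ b n → count n (labels (branch b l r)) ≤ count n (labels l) + count n (labels r)
    count-branch≤ true  n = ℕ.m≤m+n _ _
    count-branch≤ false n = ℕ.m≤n+m _ _

  InjLabels-branch : ∀ b → InjLabels (branch b l r)
  InjLabels-branch b n = ℕ.≤-trans (count-branch≤ b n) (count-subtrees≤1 n)

  root∉branch : ∀ b → v ∉ labels (branch b l r)
  root∉branch b v∈ = ℕ.<-irrefl refl (ℕ.≤-trans (s≤s (ℕ.≤-trans (∈⇒1≤count v∈) (count-branch≤ b v)))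
                                                  (ℕ.≤-trans count-at-root (inj v)))
    where
    count-at-root : suc (count v (labels l) + count v (labels r)) ≤ count v (labels (node v l r))
    count-at-root rewrite ≡ᵇ-refl v = s≤s (ℕ.≤-reflexive (sym (count-++ v (labels l) (labels r))))

  branches-disjoint : ∀ {b c n} → b ≢ c → n ∈ labels (branch b l r) → n ∉ labels (branch c l r)
  branches-disjoint {true}  {true}  b≢c = contradiction refl b≢c
  branches-disjoint {false} {false} b≢c = contradiction refl b≢c
  branches-disjoint {true}  {false} _ n∈l n∈r =
    ℕ.<-irrefl refl (ℕ.≤-trans (ℕ.+-mono-≤ (∈⇒1≤count n∈l) (∈⇒1≤count n∈r)) (count-subtrees≤1 _))
  branches-disjoint {false} {true}  _ n∈r n∈l =
    ℕ.<-irrefl refl (ℕ.≤-trans (ℕ.+-mono-≤ (∈⇒1≤count n∈l) (∈⇒1≤count n∈r)) (count-subtrees≤1 _))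

labels-branch⊆ : ∀ b {v l r n} → n ∈ labels (branch b l r) → n ∈ labels (node v l r)
labels-branch⊆ true      = there ∘ ∈-++⁺ˡ
labels-branch⊆ false {l = l} = there ∘ ∈-++⁺ʳ (labels l)

clauseOf-node : ∀ v l r b w → clauseOf (node v l r) (b ∷ w) ≡ lit v b ∷ clauseOf (branch b l r) w
clauseOf-node v l r true  w = refl
clauseOf-node v l r false w = refl

∈clauseOf-node⁺ : ∀ v l r b w {x} → x ∈ lit v b ∷ clauseOf (branch b l r) w →
  x ∈ clauseOf (node v l r) (b ∷ w)
∈clauseOf-node⁺ v l r b w = subst (_ ∈_) (sym (clauseOf-node v l r b w))

∈clauseOf-node⁻ : ∀ v l r b w {x} → x ∈ clauseOf (node v l r) (b ∷ w) →
  x ∈ lit v b ∷ clauseOf (branch b l r) w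
∈clauseOf-node⁻ v l r b w = subst (_ ∈_) (clauseOf-node v l r b w)

IsLeaf-node⁺ : ∀ {v l r w} b → IsLeaf (branch b l r) w → IsLeaf (node v l r) (b ∷ w)
IsLeaf-node⁺ true  = goL
IsLeaf-node⁺ false = goR

IsLeaf-tail : ∀ {v l r b w} → IsLeaf (node v l r) (b ∷ w) → IsLeaf (branch b l r) w
IsLeaf-tail (goL p) = p
IsLeaf-tail (goR p) = p

IsLeaf-node⁻ : ∀ {v l r w} → IsLeaf (node v l r) w →
  Σ Bool λ b → Σ Path λ w₁ → w ≡ b ∷ w₁ × IsLeaf (branch b l r) w₁
IsLeaf-node⁻ (goL p) = true  , _ , refl , p
IsLeaf-node⁻ (goR p) = false , _ , refl , p

var∈labels : ∀ {x} S w → x ∈ clauseOf S w → var x ∈ labels S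
var∈labels (node v l r) (true  ∷ w) (here e)  = here (cong var e)
var∈labels (node v l r) (true  ∷ w) (there m) = there (∈-++⁺ˡ (var∈labels l w m))
var∈labels (node v l r) (false ∷ w) (here e)  = here (cong var e)
var∈labels (node v l r) (false ∷ w) (there m) = there (∈-++⁺ʳ (labels l) (var∈labels r w m))

Through⇒∈ : ∀ {x} S w → Through S x w → x ∈ clauseOf S w
Through⇒∈ (node v l r) (true  ∷ w) (inj₁ (e₁ , e₂)) = here (sym (cong₂ lit e₁ e₂))
Through⇒∈ (node v l r) (true  ∷ w) (inj₂ t)         = there (Through⇒∈ l w t)
Through⇒∈ (node v l r) (false ∷ w) (inj₁ (e₁ , e₂)) = here (sym (cong₂ lit e₁ e₂))
Through⇒∈ (node v l r) (false ∷ w) (inj₂ t)         = there (Through⇒∈ r w t)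

∈⇒Through : ∀ {x} S w → x ∈ clauseOf S w → Through S x w
∈⇒Through (node v l r) (true  ∷ w) (here e)  = inj₁ (sym (cong var e) , sym (cong pol e))
∈⇒Through (node v l r) (true  ∷ w) (there m) = inj₂ (∈⇒Through l w m)
∈⇒Through (node v l r) (false ∷ w) (here e)  = inj₁ (sym (cong var e) , sym (cong pol e))
∈⇒Through (node v l r) (false ∷ w) (there m) = inj₂ (∈⇒Through r w m)

clauseOf-IsClause : ∀ S w → InjLabels S → IsClause (clauseOf S w)
clauseOf-IsClause leaf w _ _ ()
clauseOf-IsClause (node v l r) [] _ _ ()
clauseOf-IsClause (node v l r) (b ∷ w) inj x x∈ cx∈
  with ∈clauseOf-node⁻ v l r b w x∈ | ∈clauseOf-node⁻ v l r b w cx∈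
... | here refl | here e    = compl-≢ x e
... | here refl | there cx∈′ = root∉branch v l r inj b (var∈labels (branch b l r) w cx∈′)
... | there x∈′ | here e    = root∉branch v l r inj b (subst (_∈ labels (branch b l r))
                                 (trans (sym (var-compl x)) (cong var e)) (var∈labels (branch b l r) w x∈′))
... | there x∈′ | there cx∈′ = clauseOf-IsClause (branch b l r) w (InjLabels-branch v l r inj b) x x∈′ cx∈′

leaves : Tree → List Path
leaves leaf = [] ∷ []
leaves (node v l r) = map (true ∷_) (leaves l) ++ map (false ∷_) (leaves r)

IsLeaf⇒∈leaves : ∀ {S w} → IsLeaf S w → w ∈ leaves S
IsLeaf⇒∈leaves lf = here refl
IsLeaf⇒∈leaves (goL p) = ∈-++⁺ˡ (∈-map⁺ (true ∷_) (IsLeaf⇒∈leaves p))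
IsLeaf⇒∈leaves {node v l r} (goR p) =
  ∈-++⁺ʳ (map (true ∷_) (leaves l)) (∈-map⁺ (false ∷_) (IsLeaf⇒∈leaves p))

∈leaves⇒IsLeaf : ∀ {S w} → w ∈ leaves S → IsLeaf S w
∈leaves⇒IsLeaf {leaf} (here refl) = lf
∈leaves⇒IsLeaf {node v l r} w∈ with ∈-++⁻ (map (true ∷_) (leaves l)) w∈
... | inj₁ w∈l with ∈-map⁻ (true ∷_) w∈l
...   | _ , w₁∈ , refl = goL (∈leaves⇒IsLeaf w₁∈)
∈leaves⇒IsLeaf {node v l r} w∈ | inj₂ w∈r with ∈-map⁻ (false ∷_) w∈r
...   | _ , w₁∈ , refl = goR (∈leaves⇒IsLeaf w₁∈)

falsifiedLeaf : ∀ α S → Σ Path λ w → IsLeaf S w × Falsifies α (clauseOf S w)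
falsifiedLeaf α leaf = [] , lf , λ _ ()
falsifiedLeaf α (node v l r) with α v in eq
... | false with falsifiedLeaf α l
...   | w , p , f = true ∷ w , goL p , λ { y (here refl) s → contradiction (trans (sym s) eq) λ ()
                                        ; y (there m) → f y m }
falsifiedLeaf α (node v l r) | true with falsifiedLeaf α r
...   | w , p , f = false ∷ w , goR p , λ { y (here refl) s → contradiction (trans (sym eq) s) λ ()
                                         ; y (there m) → f y m }

leaves-clash : ∀ {S w w′} → IsLeaf S w → IsLeaf S w′ → w ≢ w′ →
  Σ Lit λ z → z ∈ clauseOf S w × compl z ∈ clauseOf S w′
leaves-clash lf lf w≢w′ = contradiction refl w≢w′
leaves-clash (goL p) (goL p′) w≢w′ with leaves-clash p p′ (w≢w′ ∘ cong (true ∷_))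
... | z , m , m′ = z , there m , there m′
leaves-clash (goR p) (goR p′) w≢w′ with leaves-clash p p′ (w≢w′ ∘ cong (false ∷_))
... | z , m , m′ = z , there m , there m′
leaves-clash {node v l r} (goL _) (goR _) _ = lit v true  , here refl , here refl
leaves-clash {node v l r} (goR _) (goL _) _ = lit v false , here refl , here refl

nonEmpty : ∀ {A : Set} {xs : List A} → xs ≢ [] → Σ A (_∈ xs)
nonEmpty {xs = []}    []≢[] = contradiction refl []≢[]
nonEmpty {xs = x ∷ _} _     = x , here refl

children : Bool → List Path → List Path
children b [] = []
children b ([] ∷ V) = children b V
children b ((c ∷ w) ∷ V) with c Bool.≟ b
... | yes _ = w ∷ children b V
... | no _  = children b V

∈-children⁺ : ∀ {b w} V → (b ∷ w) ∈ V → w ∈ children b V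
∈-children⁺ {b} ((c ∷ _) ∷ V) (here refl) with c Bool.≟ b
... | yes _  = here refl
... | no c≢b = contradiction refl c≢b
∈-children⁺ ([] ∷ V) (there m) = ∈-children⁺ V m
∈-children⁺ {b} ((c ∷ _) ∷ V) (there m) with c Bool.≟ b
... | yes _ = there (∈-children⁺ V m)
... | no _  = ∈-children⁺ V m

∈-children⁻ : ∀ {b w} V → w ∈ children b V → (b ∷ w) ∈ V
∈-children⁻ ([] ∷ V) m = there (∈-children⁻ V m)
∈-children⁻ {b} ((c ∷ _) ∷ V) m with c Bool.≟ b
∈-children⁻ ((c ∷ _) ∷ V) (here refl) | yes refl = here refl
∈-children⁻ ((c ∷ _) ∷ V) (there m)   | yes _    = there (∈-children⁻ V m)
∈-children⁻ ((c ∷ _) ∷ V) m           | no _     = there (∈-children⁻ V m)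

Separates : Tree → List Path → Path → Lit → Set
Separates S V w x =
  x ∈ clauseOf S w ×
  Σ Path (λ w′ → w′ ∈ V × compl x ∈ clauseOf S w′) ×
  (∀ w′ → w′ ∈ V → x ∉ clauseOf S w′)

module _ (v : ℕ) (l r : Tree) (inj : InjLabels (node v l r))
         (V : List Path) (V-leaves : All (IsLeaf (node v l r)) V) where

  private
    leaf-of-V : ∀ {w′} → w′ ∈ V → Σ Bool λ c → Σ Path λ w₁ → w′ ≡ c ∷ w₁ × IsLeaf (branch c l r) w₁
    leaf-of-V w′∈V = IsLeaf-node⁻ (All.lookup V-leaves w′∈V)

  rootSeparates : V ≢ [] → ∀ b w₀ → children b V ≡ [] → Separates (node v l r) V (b ∷ w₀) (lit v b)
  rootSeparates V≢[] b w₀ no-b = ∈clauseOf-node⁺ v l r b w₀ (here refl) , outside , root∉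
    where
    other-side : ∀ {c w₁} → (c ∷ w₁) ∈ V → c ≢ b
    other-side {w₁ = w₁} cw₁∈V refl with () ← subst (w₁ ∈_) no-b (∈-children⁺ V cw₁∈V)
    outside : Σ Path λ w′ → w′ ∈ V × compl (lit v b) ∈ clauseOf (node v l r) w′
    outside with y , y∈V ← nonEmpty V≢[] with leaf-of-V y∈V
    ... | c , y₁ , refl , _ =
      y , y∈V , ∈clauseOf-node⁺ v l r c y₁ (here (cong (lit v) (sym (Bool.¬-not (other-side y∈V)))))
    root∉ : ∀ w′ → w′ ∈ V → lit v b ∉ clauseOf (node v l r) w′
    root∉ w′ w′∈V with leaf-of-V w′∈V
    ... | c , w₁ , refl , _ = λ m → case ∈clauseOf-node⁻ v l r c w₁ m of λ
      { (here e)  → other-side w′∈V (sym (cong pol e))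
      ; (there m) → root∉branch v l r inj c (var∈labels (branch c l r) w₁ m) }

  liftSeparates : ∀ b w₀ x → Separates (branch b l r) (children b V) w₀ x →
    Separates (node v l r) V (b ∷ w₀) x
  liftSeparates b w₀ x (x∈ , (w″ , w″∈ , cx∈) , x∉) =
    ∈clauseOf-node⁺ v l r b w₀ (there x∈) ,
    (b ∷ w″ , ∈-children⁻ V w″∈ , ∈clauseOf-node⁺ v l r b w″ (there cx∈)) ,
    x∉V
    where
    x-in-b : var x ∈ labels (branch b l r)
    x-in-b = var∈labels (branch b l r) w₀ x∈
    x∉V : ∀ w′ → w′ ∈ V → x ∉ clauseOf (node v l r) w′
    x∉V w′ w′∈V with leaf-of-V w′∈V
    ... | c , w₁ , refl , _ = λ m → case ∈clauseOf-node⁻ v l r c w₁ m of λ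
      { (here e)  → root∉branch v l r inj b (subst (_∈ labels (branch b l r)) (cong var e) x-in-b)
      ; (there m) → in-branch m }
      where
      in-branch : x ∉ clauseOf (branch c l r) w₁
      in-branch m with c Bool.≟ b
      ... | yes refl = x∉ w₁ (∈-children⁺ V w′∈V) m
      ... | no c≢b   = branches-disjoint v l r inj (≢-sym c≢b) x-in-b (var∈labels (branch c l r) w₁ m)

-- The literal on the edge where w leaves the subtree spanned by V.
separatingLiteral : ∀ S → InjLabels S → ∀ V → V ≢ [] → All (IsLeaf S) V →
  ∀ {w} → IsLeaf S w → w ∉ V → Σ Lit (Separates S V w)
separatingLiteral leaf _ [] V≢[] _ _ _ = contradiction refl V≢[]
separatingLiteral leaf _ (_ ∷ _) _ (lf ∷ _) lf w∉V = contradiction (here refl) w∉V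
separatingLiteral (node v l r) inj V V≢[] V-leaves w-leaf w∉V with IsLeaf-node⁻ w-leaf
... | b , w₀ , refl , w₀-leaf with children b V in eq
...   | [] = lit v b , rootSeparates v l r inj V V-leaves V≢[] b w₀ eq
...   | _ ∷ _ with x , sep ← separatingLiteral (branch b l r) (InjLabels-branch v l r inj b) (children b V)
                               (λ ch≡[] → case trans (sym eq) ch≡[] of λ ())
                               (All.tabulate λ w₁∈ → IsLeaf-tail (All.lookup V-leaves (∈-children⁻ V w₁∈)))
                               w₀-leaf (w∉V ∘ ∈-children⁻ V)
  = x , liftSeparates v l r inj V V-leaves b w₀ x sep

PrimeImp⇒¬⊨remove : ∀ {G C x} → PrimeImp G C → x ∈ C → ¬ (G ⊨ remove x C)
PrimeImp⇒¬⊨remove {C = C} (_ , _ , minimal) x∈C G⊨ =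
  proj₂ (∈-remove⁻ C (minimal _ (remove-⊆ᶜ _ C) G⊨ _ x∈C)) refl

-- A shortest clause implied by G′ but not by G would be a prime implicate of G′, hence of G.
Equivalent⇒⊨ : ∀ {G G′} → (∀ X → IsClause X → Dec (G ⊨ X)) → Equivalent G G′ →
  ∀ X → IsClause X → G′ ⊨ X → G ⊨ X
Equivalent⇒⊨ {G} {G′} ⊨? eqv X = go (length X) X ℕ.≤-refl
  where
  go : ∀ n X → length X ≤ n → IsClause X → G′ ⊨ X → G ⊨ X
  go n X len≤n isX G′⊨X with ⊨? X isX
  ... | yes G⊨X = G⊨X
  ... | no G⊭X = contradiction (proj₁ (proj₂ (proj₂ (eqv X) (isX , G′⊨X , minimal)))) G⊭X
    where
    minimal : ∀ C′ → C′ ⊆ᶜ X → G′ ⊨ C′ → X ⊆ᶜ C′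
    minimal C′ C′⊆X G′⊨C′ x x∈X with x ∈ˡ? C′
    ... | yes x∈C′ = x∈C′
    ... | no x∉C′ = contradiction (⊨-weaken (remove-⊆ᶜ x X) (shorter n len≤n)) G⊭X
      where
      shorter : ∀ m → length X ≤ m → G ⊨ remove x X
      shorter zero    len≤0 = contradiction (ℕ.<-≤-trans (length-remove X x∈X) len≤0) λ ()
      shorter (suc m) len≤m = go m (remove x X) (s≤s⁻¹ (ℕ.<-≤-trans (length-remove X x∈X) len≤m))
        (IsClause-⊆ᶜ (remove-⊆ᶜ x X) isX)
        (⊨-weaken (λ y y∈ → ∈-remove⁺ X (C′⊆X y y∈) λ { refl → x∉C′ y∈ }) G′⊨C′)

Falsifies? : ∀ α C → Dec (Falsifies α C)
Falsifies? α C =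
  map′ (λ all y → All.lookup all) (λ f → All.tabulate (f _)) (All.all? (λ y → ¬? (SatLit? α y)) C)

firstFalsified : Assignment → ClauseList → Clause
firstFalsified α G = fromMaybe [] (head (filter (Falsifies? α) G))

firstFalsified-spec : ∀ α G →
  (firstFalsified α G ∈ G × Falsifies α (firstFalsified α G)) ⊎ SatCS α G
firstFalsified-spec α G with filter (Falsifies? α) G in eq
... | E ∷ _ = inj₁ (∈-filter⁻ (Falsifies? α) (subst (E ∈_) (sym eq) (here refl)))
... | [] = inj₂ (All.tabulate sat)
  where
  sat : ∀ {E} → E ∈ G → SatClause α E
  sat {E} E∈G with any? (SatLit? α) E
  ... | yes s = s
  ... | no ¬s = case subst (E ∈_) eq (∈-filter⁺ (Falsifies? α) E∈G (λ y y∈ sy → ¬s (lose y∈ sy))) of λ ()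

firstFalsified-cong : ∀ {α α′} → (∀ n → α n ≡ α′ n) → ∀ G → firstFalsified α G ≡ firstFalsified α′ G
firstFalsified-cong {α} {α′} α≗α′ G =
  cong (fromMaybe [] ∘ head) (filter-≐ (Falsifies? α) (Falsifies? α′) (to , from) G)
  where
  to : ∀ {E} → Falsifies α E → Falsifies α′ E
  to f y y∈ = f y y∈ ∘ trans (α≗α′ (var y))
  from : ∀ {E} → Falsifies α′ E → Falsifies α E
  from f y y∈ = f y y∈ ∘ trans (sym (α≗α′ (var y)))

module _ {x C C′ E} (spec : ∀ y → (y ∈ E) ⇔′ ((y ∈ C × y ≢ x) ⊎ (y ∈ C′ × y ≢ compl x))) where

  resolvent⊇left : ∀ y → y ∈ C → y ≢ x → y ∈ E
  resolvent⊇left y y∈ y≢x = proj₂ (spec y) (inj₁ (y∈ , y≢x))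

  resolvent⊇right : ∀ y → y ∈ C′ → y ≢ compl x → y ∈ E
  resolvent⊇right y y∈ y≢cx = proj₂ (spec y) (inj₂ (y∈ , y≢cx))

Res-sound : ∀ {G C} → Res G C → G ⊨ C
Res-sound (axiom C∈G) α s = SatCS-∈ₛ s C∈G
Res-sound (resolve x d e _ _ _ spec) α s with find (Res-sound d α s)
... | y , y∈C , sy with y ≟ˡ x
...   | no y≢x = lose (resolvent⊇left spec y y∈C y≢x) sy
...   | yes refl with find (Res-sound e α s)
...     | z , z∈C′ , sz with z ≟ˡ compl y
...       | yes refl = contradiction sy (SatLit-compl⇒¬SatLit {α} {y} sz)
...       | no z≢cy  = lose (resolvent⊇right spec z z∈C′ z≢cy) sz

refutation⇒Unsat : ∀ {G C} → Res G C → EmptyClause C → Unsat G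
refutation⇒Unsat d empty (α , s) with find (Res-sound d α s)
... | y , y∈C , _ = empty y y∈C

hcombUnder : Maybe Bool → ℕ → ℕ → ℕ
hcombUnder (just false) a b = a
hcombUnder (just true)  a b = b
hcombUnder nothing      a b = hcomb a b

-- A node whose variable is assigned is replaced by its subtree whose clauses ρ does not satisfy.
htsUnder : Tree → PAssignment → ℕ
htsUnder leaf ρ = 0
htsUnder (node v l r) ρ = hcombUnder (ρ v) (htsUnder l ρ) (htsUnder r ρ)

htsUnder-unassigned : ∀ S → htsUnder S (λ _ → nothing) ≡ hts S
htsUnder-unassigned leaf = refl
htsUnder-unassigned (node v l r) rewrite htsUnder-unassigned l | htsUnder-unassigned r = refl

update : PAssignment → ℕ → Bool → PAssignment
update ρ v c n = if n ≡ᵇ v then just c else ρ n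

update-≡ : ∀ ρ v c → update ρ v c v ≡ just c
update-≡ ρ v c rewrite ≡ᵇ-refl v = refl

update-≢ : ∀ ρ v c n → n ≢ v → update ρ v c n ≡ ρ n
update-≢ ρ v c n n≢v rewrite ≢⇒≡ᵇ-false n≢v = refl

htsUnder-update-fresh : ∀ S ρ v c → v ∉ labels S → htsUnder S (update ρ v c) ≡ htsUnder S ρ
htsUnder-update-fresh leaf ρ v c _ = refl
htsUnder-update-fresh (node w l r) ρ v c v∉
  rewrite update-≢ ρ v c w (λ w≡v → v∉ (here (sym w≡v)))
        | htsUnder-update-fresh l ρ v c (v∉ ∘ labels-branch⊆ true)
        | htsUnder-update-fresh r ρ v c (v∉ ∘ labels-branch⊆ false) = refl

FalsifiedBy : PAssignment → Clause → Set
FalsifiedBy ρ C = ∀ y → y ∈ C → ρ (var y) ≡ just (not (pol y))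

htsUnder-falsifiedLeaf : ∀ {S w} ρ → IsLeaf S w → FalsifiedBy ρ (clauseOf S w) → htsUnder S ρ ≡ 0
htsUnder-falsifiedLeaf ρ lf f = refl
htsUnder-falsifiedLeaf {node v l r} ρ (goL p) f rewrite f (lit v true) (here refl) =
  htsUnder-falsifiedLeaf ρ p (λ y → f y ∘ there)
htsUnder-falsifiedLeaf {node v l r} ρ (goR p) f rewrite f (lit v false) (here refl) =
  htsUnder-falsifiedLeaf ρ p (λ y → f y ∘ there)

htsUnder-split : ∀ S → InjLabels S → ∀ ρ v → ρ v ≡ nothing →
  htsUnder S ρ ≤ hcomb (htsUnder S (update ρ v false)) (htsUnder S (update ρ v true))
htsUnder-split leaf _ ρ v _ = z≤n
htsUnder-split (node w l r) inj ρ v ρv with w ℕ.≟ v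
... | yes refl rewrite update-≡ ρ w false | update-≡ ρ w true
                     | htsUnder-update-fresh l ρ w false (root∉branch w l r inj true)
                     | htsUnder-update-fresh r ρ w true (root∉branch w l r inj false) | ρv = ℕ.≤-refl
... | no w≢v rewrite update-≢ ρ v false w w≢v | update-≢ ρ v true w w≢v with ρ w
...   | just false = htsUnder-split l (InjLabels-branch w l r inj true) ρ v ρv
...   | just true  = htsUnder-split r (InjLabels-branch w l r inj false) ρ v ρv
...   | nothing with v ∈ⁿ? labels l
...     | yes v∈l rewrite htsUnder-update-fresh r ρ v false (branches-disjoint w l r inj (λ ()) v∈l)
                        | htsUnder-update-fresh r ρ v true  (branches-disjoint w l r inj (λ ()) v∈l) =
  ℕ.≤-trans (hcomb-mono-≤ {b = htsUnder r ρ}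
              (htsUnder-split l (InjLabels-branch w l r inj true) ρ v ρv) ℕ.≤-refl)
            (hcomb-distribʳ-≤ (htsUnder l (update ρ v false)) (htsUnder l (update ρ v true)) (htsUnder r ρ))
...     | no v∉l rewrite htsUnder-update-fresh l ρ v false v∉l
                       | htsUnder-update-fresh l ρ v true  v∉l =
  ℕ.≤-trans (hcomb-mono-≤ {a = htsUnder l ρ}
              ℕ.≤-refl (htsUnder-split r (InjLabels-branch w l r inj false) ρ v ρv))
            (hcomb-distribˡ-≤ (htsUnder l ρ) (htsUnder r (update ρ v false)) (htsUnder r (update ρ v true)))

premise-falsified : ∀ {ρ x C E} → (∀ y → y ∈ C → y ≢ x → y ∈ E) → FalsifiedBy ρ E →
  ρ (var x) ≡ just (not (pol x)) → FalsifiedBy ρ C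
premise-falsified {x = x} C⊆E f ρx y y∈C with y ≟ˡ x
... | yes refl = ρx
... | no y≢x   = f y (C⊆E y y∈C y≢x)

FalsifiedBy-update : ∀ {ρ v c E} → ρ v ≡ nothing → FalsifiedBy ρ E → FalsifiedBy (update ρ v c) E
FalsifiedBy-update {ρ} {v} {c} ρv f y y∈E = trans (update-≢ ρ v c (var y) y≢v) (f y y∈E)
  where
  y≢v : var y ≢ v
  y≢v refl with () ← trans (sym (f y y∈E)) ρv

hcomb-swap : ∀ (f : Bool → ℕ) b → hcomb (f false) (f true) ≡ hcomb (f (not b)) (f b)
hcomb-swap f true  = refl
hcomb-swap f false = hcomb-comm (f false) (f true)

-- At an unassigned resolved variable the premises are falsified by the two extensions of ρ,
-- and htsUnder-split combines the two bounds.
htsUnder≤htsR : ∀ S → InjLabels S → (G : ClauseList) →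
  (∀ E → E ∈ G → Σ Path λ w → IsLeaf S w × E ≈ᶜ clauseOf S w) →
  ∀ {C} (d : Res G C) ρ → FalsifiedBy ρ C → htsUnder S ρ ≤ htsR d
htsUnder≤htsR S inj G G-leaves (axiom C∈G) ρ f with find C∈G
... | E , E∈G , C≈E with G-leaves E E∈G
...   | w , w-leaf , E≈w
  rewrite htsUnder-falsifiedLeaf ρ w-leaf (λ y → f y ∘ proj₂ (C≈E y) ∘ proj₂ (E≈w y)) = z≤n
htsUnder≤htsR S inj G G-leaves (resolve (lit v b) d e _ _ _ spec) ρ f with ρ v in ρv
... | just c with c Bool.≟ not b
...   | yes refl = ℕ.≤-trans (htsUnder≤htsR S inj G G-leaves d ρ
                               (premise-falsified (resolvent⊇left spec) f ρv))
                             (m≤hcomb (htsR d) (htsR e))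
...   | no c≢nb  = ℕ.≤-trans (htsUnder≤htsR S inj G G-leaves e ρ (premise-falsified (resolvent⊇right spec) f
                               (trans ρv (cong just (Bool.¬-not c≢nb)))))
                             (n≤hcomb (htsR d) (htsR e))
htsUnder≤htsR S inj G G-leaves (resolve (lit v b) d e _ _ _ spec) ρ f | nothing =
  begin
    htsUnder S ρ                  ≤⟨ htsUnder-split S inj ρ v ρv ⟩
    hcomb (H false) (H true)      ≡⟨ hcomb-swap H b ⟩
    hcomb (H (not b)) (H b)       ≤⟨ hcomb-mono-≤ (htsUnder≤htsR S inj G G-leaves d _ f₁)
                                                  (htsUnder≤htsR S inj G G-leaves e _ f₂) ⟩
    hcomb (htsR d) (htsR e)       ∎
  where
  open ℕ.≤-Reasoning
  H : Bool → ℕ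
  H c = htsUnder S (update ρ v c)
  f₁ = premise-falsified (resolvent⊇left spec) (FalsifiedBy-update ρv f) (update-≡ ρ v (not b))
  f₂ = premise-falsified (resolvent⊇right spec) (FalsifiedBy-update ρv f)
                         (trans (update-≡ ρ v b) (cong just (sym (Bool.not-involutive b))))

xor-≢ : ∀ {b c} → c ≢ b → b xor c ≡ true
xor-≢ {true}  {true}  c≢b = contradiction refl c≢b
xor-≢ {true}  {false} _   = refl
xor-≢ {false} {true}  _   = refl
xor-≢ {false} {false} c≢b = contradiction refl c≢b

NotSatisfiedBy : PAssignment → Clause → Set
NotSatisfiedBy φ C = ∀ y → y ∈ C → litTrue φ y ≡ false

restrict : PAssignment → Clause → Clause
restrict φ = filterᵇ (not ∘ litFalse φ)

restrict-keep : ∀ φ x C → litFalse φ x ≡ false → restrict φ (x ∷ C) ≡ x ∷ restrict φ C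
restrict-keep φ x C ¬fx rewrite ¬fx = refl

restrict-drop : ∀ φ x C → litFalse φ x ≡ true → restrict φ (x ∷ C) ≡ restrict φ C
restrict-drop φ x C fx rewrite fx = refl

module _ (φ : PAssignment) (v : ℕ) (c : Bool) where

  litTrue-unassigned : φ v ≡ nothing → litTrue φ (lit v c) ≡ false
  litTrue-unassigned φv rewrite φv = refl

  litFalse-unassigned : φ v ≡ nothing → litFalse φ (lit v c) ≡ false
  litFalse-unassigned φv rewrite φv = refl

  litTrue-assigned : ∀ {b} → φ v ≡ just b → litTrue φ (lit v c) ≡ not (b xor c)
  litTrue-assigned φv rewrite φv = refl

  litFalse-assigned : ∀ {b} → φ v ≡ just b → litFalse φ (lit v c) ≡ b xor c
  litFalse-assigned φv rewrite φv = refl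

Agrees : PAssignment → Assignment → Set
Agrees φ α = ∀ n b → φ n ≡ just b → α n ≡ b

extend : PAssignment → Assignment → Assignment
extend φ β n with φ n
... | just b  = b
... | nothing = β n

extend-agrees : ∀ φ β → Agrees φ (extend φ β)
extend-agrees φ β n b φn rewrite φn = refl

extend-unassigned : ∀ φ β n → φ n ≡ nothing → extend φ β n ≡ β n
extend-unassigned φ β n φn rewrite φn = refl

litFalse-agrees : ∀ {φ α y} → Agrees φ α → SatLit α y → litFalse φ y ≡ false
litFalse-agrees {φ} {α} {lit v c} agree sy with φ v in φv
... | just b  = trans (cong (_xor c) (trans (sym (agree v b φv)) sy)) (Bool.xor-same c)
... | nothing = refl

any-false : ∀ {φ K} → NotSatisfiedBy φ K → any (litTrue φ) K ≡ false
any-false {K = []} _ = refl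
any-false {φ} {y ∷ K} ns rewrite ns y (here refl) = any-false {φ} (λ z → ns z ∘ there)

∈-*ₚ⁻ : ∀ {φ E} G → E ∈ φ *ₚ G → Σ Clause λ K → K ∈ G × E ≡ restrict φ K
∈-*ₚ⁻ {φ} G E∈ with ∈-map⁻ (restrict φ) E∈
... | K , K∈ , refl = K , proj₁ (∈-filter⁻ (T? ∘ not ∘ any (litTrue φ)) K∈) , refl

∈-*ₚ⁺ : ∀ {φ K} G → K ∈ G → NotSatisfiedBy φ K → restrict φ K ∈ φ *ₚ G
∈-*ₚ⁺ {φ} G K∈G ns =
  ∈-map⁺ (restrict φ)
    (∈-filter⁺ (T? ∘ not ∘ any (litTrue φ)) K∈G (subst (T ∘ not) (sym (any-false {φ} ns)) _))

∈-restrict⁻ : ∀ {φ y} C → y ∈ restrict φ C → y ∈ C × litFalse φ y ≡ false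
∈-restrict⁻ {φ} {y} C y∈ with ∈-filter⁻ (T? ∘ not ∘ litFalse φ) y∈
... | y∈C , t with litFalse φ y
...   | false = y∈C , refl

∈-restrict⁺ : ∀ {φ y} C → y ∈ C → litFalse φ y ≡ false → y ∈ restrict φ C
∈-restrict⁺ {φ} C y∈C ¬f = ∈-filter⁺ (T? ∘ not ∘ litFalse φ) y∈C (subst (T ∘ not) (sym ¬f) _)

restrict-≈ᶜ : ∀ {φ C C′} → C ≈ᶜ C′ → restrict φ C ≈ᶜ restrict φ C′
restrict-≈ᶜ {φ} {C} {C′} C≈C′ y =
  (λ y∈ → let y∈C , ¬f = ∈-restrict⁻ {φ} C y∈ in ∈-restrict⁺ {φ} C′ (proj₁ (C≈C′ y) y∈C) ¬f) ,
  (λ y∈ → let y∈C′ , ¬f = ∈-restrict⁻ {φ} C′ y∈ in ∈-restrict⁺ {φ} C (proj₂ (C≈C′ y) y∈C′) ¬f)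

restrict-unassigned : ∀ φ C → (∀ y → y ∈ C → φ (var y) ≡ nothing) → restrict φ C ≡ C
restrict-unassigned φ [] _ = refl
restrict-unassigned φ (lit v c ∷ C) unassigned =
  trans (restrict-keep φ (lit v c) C (litFalse-unassigned φ v c (unassigned _ (here refl))))
        (cong (lit v c ∷_) (restrict-unassigned φ C (λ y → unassigned y ∘ there)))

SatCS-*ₚ : ∀ {φ α} G → Agrees φ α → SatCS α G → SatCS α (φ *ₚ G)
SatCS-*ₚ {φ} {α} G agree s = All.tabulate sat
  where
  sat : ∀ {E} → E ∈ φ *ₚ G → SatClause α E
  sat E∈ with ∈-*ₚ⁻ {φ} G E∈
  ... | K , K∈G , refl with find (All.lookup s K∈G)
  ...   | y , y∈K , sy = lose (∈-restrict⁺ {φ} K y∈K (litFalse-agrees {φ} {α} {y} agree sy)) sy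

-- The hypotheses of treeDerivation at a node, transported to its subtrees.
module RootStep (φ : PAssignment) (G : ClauseList) (v : ℕ) (l r : Tree) (inj : InjLabels (node v l r))
         (P : Clause) (P-fresh : ∀ y → y ∈ P → var y ∉ labels (node v l r))
         (hyp : ∀ w → IsLeaf (node v l r) w → NotSatisfiedBy φ (clauseOf (node v l r) w) →
                (P ++ restrict φ (clauseOf (node v l r) w)) ∈ₛ G) where

  unassigned-hyp : φ v ≡ nothing → ∀ c w → IsLeaf (branch c l r) w →
    NotSatisfiedBy φ (clauseOf (branch c l r) w) →
    ((lit v c ∷ P) ++ restrict φ (clauseOf (branch c l r) w)) ∈ₛ G
  unassigned-hyp φv c w w-leaf ns =
    ∈ₛ-resp-≈ᶜ (↭⇒≈ᶜ (shift (lit v c) P _))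
      (subst (λ K → (P ++ K) ∈ₛ G) (trans (cong (restrict φ) (clauseOf-node v l r c w))
                                        (restrict-keep φ (lit v c) _ (litFalse-unassigned φ v c φv)))
        (hyp (c ∷ w) (IsLeaf-node⁺ c w-leaf) ns′))
    where
    ns′ : NotSatisfiedBy φ (clauseOf (node v l r) (c ∷ w))
    ns′ y y∈ with ∈clauseOf-node⁻ v l r c w y∈
    ... | here refl = litTrue-unassigned φ v c φv
    ... | there m   = ns y m

  assigned-hyp : ∀ {b c} → φ v ≡ just b → c ≢ b → ∀ w → IsLeaf (branch c l r) w →
    NotSatisfiedBy φ (clauseOf (branch c l r) w) → (P ++ restrict φ (clauseOf (branch c l r) w)) ∈ₛ G
  assigned-hyp {b} {c} φv c≢b w w-leaf ns =
    subst (λ K → (P ++ K) ∈ₛ G) (trans (cong (restrict φ) (clauseOf-node v l r c w))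
                                      (restrict-drop φ (lit v c) _ lit-false))
      (hyp (c ∷ w) (IsLeaf-node⁺ c w-leaf) ns′)
    where
    lit-false : litFalse φ (lit v c) ≡ true
    lit-false = trans (litFalse-assigned φ v c φv) (xor-≢ c≢b)
    ns′ : NotSatisfiedBy φ (clauseOf (node v l r) (c ∷ w))
    ns′ y y∈ with ∈clauseOf-node⁻ v l r c w y∈
    ... | here refl = trans (litTrue-assigned φ v c φv) (cong not (xor-≢ c≢b))
    ... | there m   = ns y m

  P-fresh-branch : ∀ c y → y ∈ P → var y ∉ labels (branch c l r)
  P-fresh-branch c y y∈P = P-fresh y y∈P ∘ labels-branch⊆ c

  extended-fresh : ∀ c y → y ∈ lit v c ∷ P → var y ∉ labels (branch c l r)
  extended-fresh c y (here refl) = root∉branch v l r inj c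
  extended-fresh c y (there y∈P) = P-fresh-branch c y y∈P

  extended-IsClause : IsClause P → ∀ c → IsClause (lit v c ∷ P)
  extended-IsClause isP c = IsClause-∷ isP (λ m → P-fresh _ m (here refl))

  resolvent-spec : ∀ y → (y ∈ P) ⇔′ ((y ∈ lit v true ∷ P × y ≢ lit v true) ⊎
                                    (y ∈ lit v false ∷ P × y ≢ lit v false))
  resolvent-spec y = (λ m → inj₁ (there m , λ { refl → P-fresh y m (here refl) }))
                   , λ { (inj₁ (here refl , y≢x)) → contradiction refl y≢x ; (inj₁ (there m , _)) → m
                       ; (inj₂ (here refl , y≢x)) → contradiction refl y≢x ; (inj₂ (there m , _)) → m }

treeDerivation : ∀ φ G S → InjLabels S → (P : Clause) → IsClause P →
  (∀ y → y ∈ P → var y ∉ labels S) →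
  (∀ w → IsLeaf S w → NotSatisfiedBy φ (clauseOf S w) → (P ++ restrict φ (clauseOf S w)) ∈ₛ G) →
  Σ (Res G P) λ d → htsR d ≤ hts S
treeDerivation φ G leaf _ P _ _ hyp =
  axiom (subst (_∈ₛ G) (++-identityʳ P) (hyp [] lf λ _ ())) , z≤n
treeDerivation φ G (node v l r) inj P isP P-fresh hyp = byRoot (φ v) refl
  where
  open RootStep φ G v l r inj P P-fresh hyp
  byRoot : ∀ a → φ v ≡ a → Σ (Res G P) λ d → htsR d ≤ hts (node v l r)
  byRoot (just true) φv
    with d , d≤ ← treeDerivation φ G r (InjLabels-branch v l r inj false) P isP
                    (P-fresh-branch false) (assigned-hyp φv λ ())
    = d , ℕ.≤-trans d≤ (n≤hcomb (hts l) (hts r))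
  byRoot (just false) φv
    with d , d≤ ← treeDerivation φ G l (InjLabels-branch v l r inj true) P isP
                    (P-fresh-branch true) (assigned-hyp φv λ ())
    = d , ℕ.≤-trans d≤ (m≤hcomb (hts l) (hts r))
  byRoot nothing φv
    with dₗ , dₗ≤ ← treeDerivation φ G l (InjLabels-branch v l r inj true) (lit v true ∷ P)
                      (extended-IsClause isP true) (extended-fresh true) (unassigned-hyp φv true)
       | dᵣ , dᵣ≤ ← treeDerivation φ G r (InjLabels-branch v l r inj false) (lit v false ∷ P)
                      (extended-IsClause isP false) (extended-fresh false) (unassigned-hyp φv false)
    = resolve (lit v true) dₗ dᵣ (here refl) (here refl) isP resolvent-spec , hcomb-mono-≤ dₗ≤ dᵣ≤

∈vars : ∀ {C y} G → C ∈ G → y ∈ C → var y ∈ vars G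
∈vars (C ∷ G) (here refl) y∈C = ∈-++⁺ˡ (∈-map⁺ var y∈C)
∈vars (C ∷ G) (there C∈G) y∈C = ∈-++⁺ʳ (map var C) (∈vars G C∈G y∈C)

module Doped (F : ClauseList) (T : Tree) (u : Clause → ℕ) (tr : TreeRep T F) (dop : Doping F u) where

  inj : InjLabels T
  inj = proj₁ tr

  DF : ClauseList
  DF = D F u

  Cw : Path → Clause
  Cw = clauseOf T

  uw : Path → ℕ
  uw = uLeaf T u

  doped : Path → Clause
  doped w = pos (uw w) ∷ Cw w

  Cw-IsClause : ∀ w → IsClause (Cw w)
  Cw-IsClause w = clauseOf-IsClause T w inj

  Cw∈F : ∀ {w} → IsLeaf T w → Cw w ∈ₛ F
  Cw∈F {w} w-leaf = proj₂ (proj₂ tr (Cw w)) (w , w-leaf , ≈ᶜ-refl)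

  F⇒leaf : ∀ {C} → C ∈ₛ F → Σ Path λ w → IsLeaf T w × C ≈ᶜ Cw w
  F⇒leaf {C} = proj₁ (proj₂ tr C)

  uw∉vars : ∀ {w} → IsLeaf T w → uw w ∉ vars F
  uw∉vars {w} w-leaf = proj₂ (proj₂ dop) (Cw w) (Cw∈F w-leaf)

  Cw-var∈vars : ∀ {w y} → IsLeaf T w → y ∈ Cw w → var y ∈ vars F
  Cw-var∈vars w-leaf y∈ with find (Cw∈F w-leaf)
  ... | C , C∈F , Cw≈C = ∈vars F C∈F (proj₁ (Cw≈C _) y∈)

  uw≢var : ∀ {w w′ y} → IsLeaf T w → IsLeaf T w′ → y ∈ Cw w′ → var y ≢ uw w
  uw≢var w-leaf w′-leaf y∈ eq = uw∉vars w-leaf (subst (_∈ vars F) eq (Cw-var∈vars w′-leaf y∈))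

  Cw-injective : ∀ {w w′} → IsLeaf T w → IsLeaf T w′ → Cw w ≈ᶜ Cw w′ → w ≡ w′
  Cw-injective {w} {w′} w-leaf w′-leaf eq with w ≟ᵖ w′
  ... | yes w≡w′ = w≡w′
  ... | no w≢w′ with leaves-clash w-leaf w′-leaf w≢w′
  ...   | z , z∈ , cz∈ = contradiction (proj₂ (eq _) cz∈) (Cw-IsClause w z z∈)

  uw-injective : ∀ {w w′} → IsLeaf T w → IsLeaf T w′ → uw w ≡ uw w′ → w ≡ w′
  uw-injective {w} {w′} w-leaf w′-leaf eq =
    Cw-injective w-leaf w′-leaf (proj₁ (proj₂ dop) (Cw w) (Cw w′) (Cw∈F w-leaf) (Cw∈F w′-leaf) eq)

  doped-IsClause : ∀ {w} → IsLeaf T w → IsClause (doped w)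
  doped-IsClause {w} w-leaf = IsClause-∷ (Cw-IsClause w) (λ m → uw≢var w-leaf w-leaf m refl)

  private
    doped-resp : ∀ {C w} → C ∈ₛ F → IsLeaf T w → C ≈ᶜ Cw w → (pos (u C) ∷ C) ≈ᶜ doped w
    doped-resp {C} {w} C∈F w-leaf C≈Cw =
      subst (λ n → (pos (u C) ∷ C) ≈ᶜ (pos n ∷ Cw w)) (proj₁ dop C (Cw w) C∈F (Cw∈F w-leaf) C≈Cw)
            (∷-cong-≈ᶜ (pos (u C)) C≈Cw)

  doped∈D : ∀ {w} → IsLeaf T w → doped w ∈ₛ DF
  doped∈D {w} w-leaf with find (Cw∈F w-leaf)
  ... | C , C∈F , Cw≈C =
    lose (∈-map⁺ (λ C → pos (u C) ∷ C) C∈F) (≈ᶜ-sym (doped-resp (∈⇒∈ₛ C∈F) w-leaf (≈ᶜ-sym Cw≈C)))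

  D⇒leaf : ∀ {E} → E ∈ DF → Σ Path λ w → IsLeaf T w × E ≈ᶜ doped w
  D⇒leaf E∈D with ∈-map⁻ (λ C → pos (u C) ∷ C) E∈D
  ... | C , C∈F , refl with F⇒leaf (∈⇒∈ₛ C∈F)
  ...   | w , w-leaf , C≈Cw = w , w-leaf , doped-resp (∈⇒∈ₛ C∈F) w-leaf C≈Cw

  Dₛ⇒leaf : ∀ {E} → E ∈ₛ DF → Σ Path λ w → IsLeaf T w × E ≈ᶜ doped w
  Dₛ⇒leaf E∈D with find E∈D
  ... | E′ , E′∈D , E≈E′ with D⇒leaf E′∈D
  ...   | w , w-leaf , E′≈ = w , w-leaf , ≈ᶜ-trans E≈E′ E′≈

  satisfies-D : ∀ {α w} → IsLeaf T w → Falsifies α (Cw w) → α (uw w) ≡ true → SatCS α DF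
  satisfies-D {α} {w} w-leaf f uw-true = All.tabulate sat
    where
    sat : ∀ {E} → E ∈ DF → SatClause α E
    sat E∈D with D⇒leaf E∈D
    ... | w′ , w′-leaf , E≈ with w′ ≟ᵖ w
    ...   | yes refl = SatClause-≈ᶜ (≈ᶜ-sym E≈) (here uw-true)
    ...   | no w′≢w with leaves-clash w′-leaf w-leaf w′≢w
    ...     | z , z∈ , cz∈ = SatClause-≈ᶜ (≈ᶜ-sym E≈) (there (lose z∈ (Falsifies-compl f cz∈)))

  Clash : Clause → Clause → Set
  Clash A X = Any (λ y → compl y ∈ X) A

  Covers : Clause → Path → Set
  Covers X w = pos (uw w) ∈ X ⊎ Clash (Cw w) X

  Covers? : ∀ X w → Dec (Covers X w)
  Covers? X w = pos (uw w) ∈ˡ? X ⊎-dec any? (λ y → compl y ∈ˡ? X) (Cw w)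

  CoversAll : Clause → Set
  CoversAll X = ∀ w → IsLeaf T w → Covers X w

  CoversAll⇒⊨ : ∀ {X} → CoversAll X → DF ⊨ X
  CoversAll⇒⊨ {X} cov α s with falsifiedLeaf α T
  ... | w , w-leaf , f with find (SatCS-∈ₛ s (doped∈D w-leaf))
  ...   | y , there y∈ , sy = contradiction sy (f y y∈)
  ...   | y , here refl , sy with cov w w-leaf
  ...     | inj₁ uw∈X = lose uw∈X sy
  ...     | inj₂ clash with find clash
  ...       | z , z∈ , cz∈X = lose cz∈X (¬SatLit⇒SatLit-compl {α} {z} (f z z∈))

  -- If w is not covered, falsify X and C_w and set u_w true: every other leaf clashes with
  -- C_w, so D(F) is satisfied.
  ⊨⇒CoversAll : ∀ {X} → IsClause X → DF ⊨ X → CoversAll X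
  ⊨⇒CoversAll {X} isX D⊨X w w-leaf with Covers? X w
  ... | yes cov = cov
  ... | no ¬cov = contradiction (D⊨X α (satisfies-D w-leaf fC uw-true)) (Falsifies⇒¬SatClause fX)
    where
    L = lit (uw w) false ∷ (Cw w ++ X)
    isL : IsClause L
    isL = IsClause-∷ (IsClause-++ (Cw-IsClause w) isX (λ y y∈ cy∈ → ¬cov (inj₂ (lose y∈ cy∈))))
                     (λ m → [ (λ m → uw≢var w-leaf w-leaf m refl) , ¬cov ∘ inj₁ ] (∈-++⁻ (Cw w) m))
    α = falsifier L
    fX : Falsifies α X
    fX y = falsifier-falsifies L isL y ∘ there ∘ ∈-++⁺ʳ (Cw w)
    fC : Falsifies α (Cw w)
    fC y = falsifier-falsifies L isL y ∘ there ∘ ∈-++⁺ˡ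
    uw-true : α (uw w) ≡ true
    uw-true = Bool.¬-not (falsifier-falsifies L isL (lit (uw w) false) (here refl))

  ⊨? : ∀ X → IsClause X → Dec (DF ⊨ X)
  ⊨? X isX with All.all? (Covers? X) (leaves T)
  ... | yes all = yes (CoversAll⇒⊨ λ w → All.lookup all ∘ IsLeaf⇒∈leaves)
  ... | no ¬all = no λ D⊨X → ¬all (All.tabulate λ m → ⊨⇒CoversAll isX D⊨X _ (∈leaves⇒IsLeaf m))

  Occ : List Path → Lit → Set
  Occ = OccV T u

  Occ? : ∀ V x → Dec (Occ V x)
  Occ? V x = map′ find (λ (w , w∈ , p) → lose w∈ p) (any? (λ w → x ∈ˡ? Cw w ⊎-dec x ≟ˡ pos (uw w)) V)

  CV : List Path → Clause
  CV V = filter (λ x → ¬? (Occ? V (compl x))) (concatMap doped V)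

  ∈CV⁻ : ∀ {x} V → x ∈ CV V → InCV T u V x
  ∈CV⁻ V x∈ with ∈-filter⁻ (λ x → ¬? (Occ? V (compl x))) x∈
  ... | x∈cands , ¬occ with find (∈-concatMap⁻ doped {xs = V} x∈cands)
  ...   | w , w∈V , here refl = (w , w∈V , inj₂ refl) , ¬occ
  ...   | w , w∈V , there x∈Cw = (w , w∈V , inj₁ x∈Cw) , ¬occ

  ∈CV⁺ : ∀ {x} V → InCV T u V x → x ∈ CV V
  ∈CV⁺ V ((w , w∈V , occ) , ¬occ) =
    ∈-filter⁺ (λ x → ¬? (Occ? V (compl x)))
      (∈-concatMap⁺ doped (lose w∈V ([ there , (λ { refl → here refl }) ] occ))) ¬occ

  InCV-IsClause : ∀ {V C} → (∀ x → x ∈ C → InCV T u V x) → IsClause C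
  InCV-IsClause C⊆CV x x∈ cx∈ = proj₂ (C⊆CV x x∈) (proj₁ (C⊆CV (compl x) cx∈))

  InCV-compl⇒¬Occ : ∀ {V x} → InCV T u V (compl x) → ¬ Occ V x
  InCV-compl⇒¬Occ {V} {x} (_ , ¬occ) = ¬occ ∘ subst (Occ V) (sym (compl-involutive x))

  module _ {V : List Path} (V-leaves : LeafSubset T V) where

    ∈V⇒leaf : ∀ {w} → w ∈ V → IsLeaf T w
    ∈V⇒leaf = All.lookup (proj₂ V-leaves)

    uw∈CV : ∀ {w} → w ∈ V → InCV T u V (pos (uw w))
    uw∈CV {w} w∈V = (w , w∈V , inj₂ refl) , ¬occ
      where
      ¬occ : ¬ Occ V (lit (uw w) false)
      ¬occ (w′ , w′∈V , inj₁ c) = uw≢var (∈V⇒leaf w∈V) (∈V⇒leaf w′∈V) c refl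

    Occ-tree : ∀ {w x} → IsLeaf T w → x ∈ Cw w → Occ V x → Σ Path λ w′ → w′ ∈ V × x ∈ Cw w′
    Occ-tree _ _ (w′ , w′∈V , inj₁ x∈) = w′ , w′∈V , x∈
    Occ-tree w-leaf x∈ (w′ , w′∈V , inj₂ refl) = contradiction refl (uw≢var (∈V⇒leaf w′∈V) w-leaf x∈)

    compl∈CV-outside : ∀ {w} → IsLeaf T w → w ∉ V → Σ Lit λ x → x ∈ Cw w × InCV T u V (compl x)
    compl∈CV-outside w-leaf w∉V
      with x , x∈ , (w′ , w′∈V , cx∈) , x∉ ←
             separatingLiteral T inj V (proj₁ V-leaves) (proj₂ V-leaves) w-leaf w∉V
      = x , x∈ , (w′ , w′∈V , inj₁ cx∈) , ¬occ
      where
      ¬occ : ¬ Occ V (compl (compl x))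
      ¬occ occ with Occ-tree w-leaf x∈ (subst (Occ V) (compl-involutive x) occ)
      ... | w″ , w″∈V , x∈′ = x∉ w″ w″∈V x∈′

    CV-partition : (∀ x → InCV T u V x ⇔′ (InUV T u V x ⊎ InPV T V x)) ×
                   (∀ x → InUV T u V x → ¬ InPV T V x)
    CV-partition = (λ x → to x , from x) , disjoint
      where
      to : ∀ x → InCV T u V x → InUV T u V x ⊎ InPV T V x
      to x ((w , w∈V , inj₂ e) , _) = inj₁ (w , w∈V , e)
      to x ((w , w∈V , inj₁ x∈) , ¬occ) =
        inj₂ ((w , w∈V , ∈⇒Through T w x∈) , λ (w′ , w′∈V , t) → ¬occ (w′ , w′∈V , inj₁ (Through⇒∈ T w′ t)))
      from : ∀ x → InUV T u V x ⊎ InPV T V x → InCV T u V x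
      from x (inj₁ (w , w∈V , refl)) = uw∈CV w∈V
      from x (inj₂ ((w , w∈V , t) , ¬t)) = (w , w∈V , inj₁ (Through⇒∈ T w t)) , ¬occ
        where
        ¬occ : ¬ Occ V (compl x)
        ¬occ (w′ , w′∈V , inj₁ c) = ¬t (w′ , w′∈V , ∈⇒Through T w′ c)
        ¬occ (w′ , w′∈V , inj₂ e) =
          uw≢var (∈V⇒leaf w′∈V) (∈V⇒leaf w∈V) (Through⇒∈ T w t) (trans (sym (var-compl x)) (cong var e))
      disjoint : ∀ x → InUV T u V x → ¬ InPV T V x
      disjoint x (w , w∈V , refl) ((w′ , w′∈V , t) , _) =
        uw≢var (∈V⇒leaf w∈V) (∈V⇒leaf w′∈V) (Through⇒∈ T w′ t) refl

    uw-Occ⇒∈V : ∀ {w} → IsLeaf T w → Occ V (pos (uw w)) → w ∈ V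
    uw-Occ⇒∈V w-leaf (w′ , w′∈V , inj₁ u∈) = contradiction refl (uw≢var w-leaf (∈V⇒leaf w′∈V) u∈)
    uw-Occ⇒∈V w-leaf (w′ , w′∈V , inj₂ e) =
      subst (_∈ V) (sym (uw-injective w-leaf (∈V⇒leaf w′∈V) (cong var e))) w′∈V

    -- Flipping x in an assignment falsifying C′ and C_w forces, via the covering condition
    -- at the newly falsified leaf, the literal x into C′.
    treeLiteral∈ : ∀ {C′} → (∀ y → y ∈ C′ → InCV T u V y) → DF ⊨ C′ →
      ∀ {x w} → w ∈ V → x ∈ Cw w → ¬ Occ V (compl x) →
      ∀ α → Falsifies α (C′ ++ Cw w) → x ∈ C′
    treeLiteral∈ {C′} C′⊆CV D⊨C′ {x} {w} w∈V x∈ ¬occ α fα with falsifiedLeaf (flipTo α x) T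
    ... | w″ , w″-leaf , f″ with ⊨⇒CoversAll (InCV-IsClause C′⊆CV) D⊨C′ w″ w″-leaf
    ...   | inj₁ u∈C′ = contradiction (w″ , uw-Occ⇒∈V w″-leaf (proj₁ (C′⊆CV _ u∈C′)) , inj₁ cx∈) ¬occ
      where
      cx∈ : compl x ∈ Cw w″
      cx∈ with w″ ≟ᵖ w
      ... | yes refl = contradiction (flipTo-sat α x) (f″ x x∈)
      ... | no w″≢w with leaves-clash w″-leaf (∈V⇒leaf w∈V) w″≢w
      ...   | z , z∈ , cz∈ with z ≟ˡ compl x
      ...     | yes refl = z∈
      ...     | no z≢cx  =
        contradiction (flipTo-preserves α x (Falsifies-compl fα (∈-++⁺ʳ C′ cz∈)) z≢cx) (f″ z z∈)
    ...   | inj₂ clash with find clash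
    ...     | y , y∈ , cy∈C′ with y ≟ˡ compl x
    ...       | yes refl = subst (_∈ C′) (compl-involutive x) cy∈C′
    ...       | no y≢cx  =
      contradiction (flipTo-preserves α x (Falsifies-compl fα (∈-++⁺ˡ cy∈C′)) y≢cx) (f″ y y∈)

    CV-minimal : ∀ {C′} → (∀ y → y ∈ C′ → InCV T u V y) → DF ⊨ C′ → ∀ x → InCV T u V x → x ∈ C′
    CV-minimal {C′} C′⊆CV D⊨C′ x ((w , w∈V , inj₂ refl) , _)
      with ⊨⇒CoversAll (InCV-IsClause C′⊆CV) D⊨C′ w (∈V⇒leaf w∈V)
    ... | inj₁ uw∈C′ = uw∈C′
    ... | inj₂ clash with find clash
    ...   | y , y∈ , cy∈C′ = contradiction (w , w∈V , inj₁ y∈) (InCV-compl⇒¬Occ (C′⊆CV (compl y) cy∈C′))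
    CV-minimal {C′} C′⊆CV D⊨C′ x ((w , w∈V , inj₁ x∈) , ¬occ) =
      treeLiteral∈ C′⊆CV D⊨C′ w∈V x∈ ¬occ (falsifier L) (falsifier-falsifies L isL)
      where
      L = C′ ++ Cw w
      isL : IsClause L
      isL = IsClause-++ (InCV-IsClause C′⊆CV) (Cw-IsClause w) λ y y∈ cy∈ →
              InCV-compl⇒¬Occ (subst (InCV T u V) (sym (compl-involutive y)) (C′⊆CV y y∈))
                              (w , w∈V , inj₁ cy∈)

  CV-prime : ∀ V C → LeafSubset T V → (∀ x → (x ∈ C) ⇔′ InCV T u V x) → PrimeImp DF C
  CV-prime V C V-leaves C≈CV = InCV-IsClause C⊆CV , CoversAll⇒⊨ covers , minimal
    where
    C⊆CV : ∀ y → y ∈ C → InCV T u V y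
    C⊆CV y = proj₁ (C≈CV y)
    covers : CoversAll C
    covers w w-leaf with w ∈ᵖ? V
    ... | yes w∈V = inj₁ (proj₂ (C≈CV _) (uw∈CV V-leaves w∈V))
    ... | no w∉V with compl∈CV-outside V-leaves w-leaf w∉V
    ...   | x , x∈ , cx∈CV = inj₂ (lose x∈ (proj₂ (C≈CV _) cx∈CV))
    minimal : ∀ C′ → C′ ⊆ᶜ C → DF ⊨ C′ → C ⊆ᶜ C′
    minimal C′ C′⊆C D⊨C′ x = CV-minimal V-leaves (λ y → C⊆CV y ∘ C′⊆C y) D⊨C′ x ∘ C⊆CV x

  module PrimeImplicate {C : Clause} (prime : PrimeImp DF C) where

    isC : IsClause C
    isC = proj₁ prime

    covers : CoversAll C
    covers = ⊨⇒CoversAll isC (proj₁ (proj₂ prime))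

    V : List Path
    V = filter (λ w → pos (uw w) ∈ˡ? C) (leaves T)

    ∈V⁺ : ∀ {w} → IsLeaf T w → pos (uw w) ∈ C → w ∈ V
    ∈V⁺ w-leaf = ∈-filter⁺ (λ w → pos (uw w) ∈ˡ? C) (IsLeaf⇒∈leaves w-leaf)

    ∈V⁻ : ∀ {w} → w ∈ V → IsLeaf T w × pos (uw w) ∈ C
    ∈V⁻ w∈V with ∈-filter⁻ (λ w → pos (uw w) ∈ˡ? C) w∈V
    ... | w∈leaves , u∈C = ∈leaves⇒IsLeaf w∈leaves , u∈C

    V≢[] : V ≢ []
    V≢[] V≡[] with falsifiedLeaf (falsifier C) T
    ... | w , w-leaf , f with covers w w-leaf
    ...   | inj₁ u∈C = case subst (w ∈_) V≡[] (∈V⁺ w-leaf u∈C) of λ ()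
    ...   | inj₂ clash with find clash
    ...     | y , y∈ , cy∈ = f y y∈ (Falsifies-compl (falsifier-falsifies C isC) cy∈)

    V-leaves : LeafSubset T V
    V-leaves = V≢[] , All.tabulate (proj₁ ∘ ∈V⁻)

    uncovered : ∀ {x} → x ∈ C → Σ Path λ w → IsLeaf T w × ¬ Covers (remove x C) w
    uncovered {x} x∈C with All.all? (Covers? (remove x C)) (leaves T)
    ... | yes all = contradiction (CoversAll⇒⊨ λ w → All.lookup all ∘ IsLeaf⇒∈leaves)
                                  (PrimeImp⇒¬⊨remove prime x∈C)
    ... | no ¬all with find (¬All⇒Any¬ (Covers? (remove x C)) (leaves T) ¬all)
    ...   | w , w∈ , ¬cov = w , ∈leaves⇒IsLeaf w∈ , ¬cov

    module _ {x w} (x∈C : x ∈ C) (w-leaf : IsLeaf T w) (cx∈ : compl x ∈ Cw w)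
             (onlyClash : ∀ z → z ∈ Cw w → compl z ∈ C → compl z ≡ x) where

      private
        R = remove (compl x) (Cw w)
        isL : IsClause (C ++ R)
        isL = IsClause-++ isC (IsClause-⊆ᶜ (remove-⊆ᶜ _ (Cw w)) (Cw-IsClause w)) noClash
          where
          noClash : ∀ z → z ∈ C → compl z ∉ R
          noClash z z∈C cz∈R with ∈-remove⁻ (Cw w) cz∈R
          ... | cz∈ , cz≢cx = cz≢cx (cong compl (trans (sym (compl-involutive z))
                                 (onlyClash (compl z) cz∈ (subst (_∈ C) (sym (compl-involutive z)) z∈C))))
        α = falsifier (C ++ R)
        fL = falsifier-falsifies (C ++ R) isL

      -- An assignment falsifying C and C_w ∖ {x̄} falsifies a leaf of V, which must contain x.
      Occ-x : Occ V x
      Occ-x with falsifiedLeaf α T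
      ... | w₂ , w₂-leaf , f₂ with covers w₂ w₂-leaf
      ...   | inj₂ clash with find clash
      ...     | y , y∈ , cy∈C = contradiction (Falsifies-compl fL (∈-++⁺ˡ cy∈C)) (f₂ y y∈)
      Occ-x | w₂ , w₂-leaf , f₂ | inj₁ u∈C = w₂ , ∈V⁺ w₂-leaf u∈C , inj₁ x∈w₂
        where
        x∈w₂ : x ∈ Cw w₂
        x∈w₂ with w₂ ≟ᵖ w
        ... | yes refl = contradiction (Falsifies-compl f₂ cx∈) (fL x (∈-++⁺ˡ x∈C))
        ... | no w₂≢w with leaves-clash w₂-leaf w-leaf w₂≢w
        ...   | z , z∈ , cz∈ with compl z ≟ˡ compl x
        ...     | yes cz≡cx = subst (_∈ Cw w₂) (compl-injective cz≡cx) z∈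
        ...     | no cz≢cx = contradiction (Falsifies-compl fL (∈-++⁺ʳ C (∈-remove⁺ (Cw w) cz∈ cz≢cx)))
                                           (f₂ z z∈)

      -- If x̄ occurred at a leaf w′ of V, the literal u_w′ could be removed from C.
      ¬Occ-compl : ¬ Occ V (compl x)
      ¬Occ-compl (w′ , w′∈V , inj₂ e) = uw≢var (proj₁ (∈V⁻ w′∈V)) w-leaf cx∈ (cong var e)
      ¬Occ-compl (w′ , w′∈V , inj₁ cx∈′) =
        PrimeImp⇒¬⊨remove prime u∈C (CoversAll⇒⊨ covers′)
        where
        w′-leaf = proj₁ (∈V⁻ w′∈V)
        u∈C = proj₂ (∈V⁻ w′∈V)
        covers′ : CoversAll (remove (pos (uw w′)) C)
        covers′ w₃ w₃-leaf with w₃ ≟ᵖ w′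
        ... | yes refl = inj₂ (lose cx∈′ (∈-remove⁺ C (subst (_∈ C) (sym (compl-involutive x)) x∈C) cx≢u))
          where
          cx≢u : compl (compl x) ≢ pos (uw w′)
          cx≢u e = uw≢var w′-leaf w-leaf cx∈ (trans (var-compl (compl x)) (cong var e))
        ... | no w₃≢w′ with covers w₃ w₃-leaf
        ...   | inj₁ u₃∈C = inj₁ (∈-remove⁺ C u₃∈C (w₃≢w′ ∘ uw-injective w₃-leaf w′-leaf ∘ cong var))
        ...   | inj₂ clash with find clash
        ...     | y , y∈ , cy∈C = inj₂ (lose y∈ (∈-remove⁺ C cy∈C
                   (λ e → uw≢var w′-leaf w₃-leaf y∈ (trans (sym (var-compl y)) (cong var e)))))

    C⊆CV : ∀ x → x ∈ C → InCV T u V x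
    C⊆CV x x∈C with uncovered x∈C
    ... | w , w-leaf , ¬cov with covers w w-leaf
    ...   | inj₁ u∈C with pos (uw w) ≟ˡ x
    ...     | yes refl = uw∈CV V-leaves (∈V⁺ w-leaf u∈C)
    ...     | no u≢x   = contradiction (inj₁ (∈-remove⁺ C u∈C u≢x)) ¬cov
    C⊆CV x x∈C | w , w-leaf , ¬cov | inj₂ clash with find clash
    ...   | y , y∈ , cy∈C with compl y ≟ˡ x
    ...     | no cy≢x  = contradiction (inj₂ (lose y∈ (∈-remove⁺ C cy∈C cy≢x))) ¬cov
    ...     | yes refl = Occ-x x∈C w-leaf cx∈ onlyClash , ¬Occ-compl x∈C w-leaf cx∈ onlyClash
      where
      cx∈ : compl (compl y) ∈ Cw w
      cx∈ = subst (_∈ Cw w) (sym (compl-involutive y)) y∈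
      onlyClash : ∀ z → z ∈ Cw w → compl z ∈ C → compl z ≡ compl y
      onlyClash z z∈ cz∈C with compl z ≟ˡ compl y
      ... | yes cz≡cy = cz≡cy
      ... | no cz≢cy  = contradiction (inj₂ (lose z∈ (∈-remove⁺ C cz∈C cz≢cy))) ¬cov

    C≈CV : ∀ x → (x ∈ C) ⇔′ InCV T u V x
    C≈CV x = C⊆CV x , CV-minimal V-leaves C⊆CV (proj₁ (proj₂ prime)) x

  prime⇔CV : ∀ C → PrimeImp DF C ⇔′ Σ (List Path) λ V → LeafSubset T V × (∀ x → (x ∈ᶜ C) ⇔′ InCV T u V x)
  prime⇔CV C = (λ prime → let open PrimeImplicate prime in V , V-leaves , C≈CV)
             , λ (V , V-leaves , C≈CV) → CV-prime V C V-leaves C≈CV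

  leavesOf : (H : ClauseList) → H ⊆ₛ DF → List Path
  leavesOf [] _ = []
  leavesOf (E ∷ H) H⊆D = proj₁ (Dₛ⇒leaf (H⊆D E (here ≈ᶜ-refl))) ∷ leavesOf H (λ E′ → H⊆D E′ ∘ there)

  ∈leavesOf⁻ : ∀ H H⊆D {w} → w ∈ leavesOf H H⊆D → IsLeaf T w × Σ Clause λ E → E ∈ₛ H × E ≈ᶜ doped w
  ∈leavesOf⁻ (E ∷ H) H⊆D (here refl) =
    let _ , w-leaf , E≈ = Dₛ⇒leaf (H⊆D E (here ≈ᶜ-refl)) in w-leaf , E , here ≈ᶜ-refl , E≈
  ∈leavesOf⁻ (E ∷ H) H⊆D (there w∈) with ∈leavesOf⁻ H (λ E′ → H⊆D E′ ∘ there) w∈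
  ... | w-leaf , E′ , E′∈H , E′≈ = w-leaf , E′ , there E′∈H , E′≈

  ∈leavesOf⁺ : ∀ H H⊆D {E} → E ∈ H → Σ Path λ w → w ∈ leavesOf H H⊆D × E ≈ᶜ doped w
  ∈leavesOf⁺ (E ∷ H) H⊆D (here refl) = _ , here refl , proj₂ (proj₂ (Dₛ⇒leaf (H⊆D E (here ≈ᶜ-refl))))
  ∈leavesOf⁺ (E ∷ H) H⊆D (there E∈H) with ∈leavesOf⁺ H (λ E′ → H⊆D E′ ∘ there) E∈H
  ... | w , w∈ , E≈ = w , there w∈ , E≈

  minimalPremise : ∀ E H (H⊆D : (E ∷ H) ⊆ₛ DF) → MinPremise (E ∷ H) (CV (leavesOf (E ∷ H) H⊆D))
  minimalPremise E H H⊆D = InCV-IsClause (λ y → ∈CV⁻ V) , H⊨CV , minimal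
    where
    V = leavesOf (E ∷ H) H⊆D
    V-leaves : LeafSubset T V
    V-leaves = (λ ()) , All.tabulate (proj₁ ∘ ∈leavesOf⁻ (E ∷ H) H⊆D)
    H⊨CV : (E ∷ H) ⊨ CV V
    H⊨CV α s with falsifiedLeaf α T
    ... | w , w-leaf , f with w ∈ᵖ? V
    ...   | no w∉V with compl∈CV-outside V-leaves w-leaf w∉V
    ...     | x , x∈ , cx∈CV = lose (∈CV⁺ V cx∈CV) (¬SatLit⇒SatLit-compl {α} {x} (f x x∈))
    H⊨CV α s | w , w-leaf , f | yes w∈V with ∈leavesOf⁻ (E ∷ H) H⊆D w∈V
    ...     | _ , E′ , E′∈H , E′≈ with find (SatClause-≈ᶜ E′≈ (SatCS-∈ₛ s E′∈H))
    ...       | y , here refl , sy = lose (∈CV⁺ V (uw∈CV V-leaves w∈V)) sy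
    ...       | y , there y∈ , sy = contradiction sy (f y y∈)
    -- Falsify C_V together with the clause C_w₀ of a dropped clause: every other clause of H
    -- clashes with C_w₀ and is therefore satisfied.
    minimal : ∀ H′ → H′ ⊂ₛ (E ∷ H) → ¬ (H′ ⊨ CV V)
    minimal H′ (H′⊆H , E₀ , E₀∈H , E₀∉H′) H′⊨CV with find E₀∈H
    ... | E₁ , E₁∈H , E₀≈E₁ with ∈leavesOf⁺ (E ∷ H) H⊆D E₁∈H
    ...   | w₀ , w₀∈V , E₁≈ = Falsifies⇒¬SatClause (λ y → fL y ∘ ∈-++⁺ʳ (Cw w₀)) (H′⊨CV α (All.tabulate sat))
      where
      w₀-leaf = proj₁ (∈leavesOf⁻ (E ∷ H) H⊆D w₀∈V)
      L = Cw w₀ ++ CV V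
      isL : IsClause L
      isL = IsClause-++ (Cw-IsClause w₀) (InCV-IsClause (λ y → ∈CV⁻ V))
              λ z z∈ cz∈ → InCV-compl⇒¬Occ (∈CV⁻ V cz∈) (w₀ , w₀∈V , inj₁ z∈)
      α = falsifier L
      fL : Falsifies α L
      fL = falsifier-falsifies L isL
      sat : ∀ {E′} → E′ ∈ H′ → SatClause α E′
      sat E′∈H′ with find (H′⊆H _ (∈⇒∈ₛ E′∈H′))
      ... | E₂ , E₂∈H , E′≈E₂ with ∈leavesOf⁺ (E ∷ H) H⊆D E₂∈H
      ...   | w , w∈V , E₂≈ with w ≟ᵖ w₀
      ...     | yes refl =
        contradiction (lose E′∈H′ (≈ᶜ-trans E₀≈E₁ (≈ᶜ-trans E₁≈ (≈ᶜ-sym (≈ᶜ-trans E′≈E₂ E₂≈))))) E₀∉H′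
      ...     | no w≢w₀ with leaves-clash (proj₁ (∈leavesOf⁻ (E ∷ H) H⊆D w∈V)) w₀-leaf w≢w₀
      ...       | z , z∈ , cz∈ = SatClause-≈ᶜ (≈ᶜ-sym (≈ᶜ-trans E′≈E₂ E₂≈))
                                   (there (lose z∈ (Falsifies-compl fL (∈-++⁺ˡ cz∈))))

  D≢[] : DF ≢ []
  D≢[] D≡[] with falsifiedLeaf (λ _ → true) T
  ... | w , w-leaf , _ = case subst (doped w ∈ₛ_) D≡[] (doped∈D w-leaf) of λ ()

  D-totalMps : TotalMps DF
  D-totalMps = D≢[] , λ where
    [] _ []≢[] → contradiction refl []≢[]
    (E ∷ H) H⊆D _ → CV (leavesOf (E ∷ H) H⊆D) , minimalPremise E H H⊆D

  doped≈CV-singleton : ∀ {w} → IsLeaf T w → ∀ x → (x ∈ doped w) ⇔′ InCV T u (w ∷ []) x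
  doped≈CV-singleton {w} w-leaf x = to , from
    where
    to : x ∈ doped w → InCV T u (w ∷ []) x
    to x∈ = (w , here refl , (case x∈ of λ { (here e) → inj₂ e ; (there m) → inj₁ m }))
          , λ { (_ , here refl , inj₁ c) → doped-IsClause w-leaf x x∈ (there c)
              ; (_ , here refl , inj₂ e) → doped-IsClause w-leaf x x∈ (here e) }
    from : InCV T u (w ∷ []) x → x ∈ doped w
    from ((_ , here refl , inj₁ c) , _) = there c
    from ((_ , here refl , inj₂ e) , _) = here e

  module Injection (F′ : ClauseList) (isF′ : IsClauseSet F′) (eqv : Equivalent DF F′) where

    i : Clause → Clause
    i C = firstFalsified (falsifier C) F′

    C-IsClause : ∀ {C} → C ∈ₛ DF → IsClause C
    C-IsClause C∈D = let _ , w-leaf , C≈ = Dₛ⇒leaf C∈D in IsClause-≈ᶜ (≈ᶜ-sym C≈) (doped-IsClause w-leaf)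

    module _ {C w} (w-leaf : IsLeaf T w) (C≈ : C ≈ᶜ doped w) where

      private
        isC : IsClause C
        isC = IsClause-≈ᶜ (≈ᶜ-sym C≈) (doped-IsClause w-leaf)
        α = falsifier C
        fα = falsifier-falsifies C isC

        F′⊨C : F′ ⊨ C
        F′⊨C = proj₁ (proj₂ (proj₁ (eqv C) (CV-prime (w ∷ []) C ((λ ()) , (w-leaf ∷ []))
                 λ x → proj₁ (doped≈CV-singleton w-leaf x) ∘ proj₁ (C≈ x)
                     , proj₂ (C≈ x) ∘ proj₂ (doped≈CV-singleton w-leaf x))))

      falsifier-other-u : ∀ {w′} → IsLeaf T w′ → w′ ≢ w → falsifier C (uw w′) ≡ true
      falsifier-other-u {w′} w′-leaf w′≢w = falsifier-outside C (uw w′) λ y y∈ e →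
        case proj₁ (C≈ y) y∈ of λ
          { (here refl) → w′≢w (sym (uw-injective w-leaf w′-leaf e))
          ; (there y∈′) → uw≢var w′-leaf w-leaf y∈′ e }

      -- D(F) implies i C, so i C covers every leaf; flipping single literals of C then
      -- shows C ⊆ i C.
      i-spec : i C ∈ F′ × Falsifies α (i C) × C ⊆ᶜ i C
      i-spec with firstFalsified-spec α F′
      ... | inj₂ s = contradiction (F′⊨C α s) (Falsifies⇒¬SatClause fα)
      ... | inj₁ (E∈F′ , fE) = E∈F′ , fE , C⊆E
        where
        E = i C
        coversE : CoversAll E
        coversE = ⊨⇒CoversAll (All.lookup (proj₁ isF′) E∈F′)
                    (Equivalent⇒⊨ ⊨? eqv E (All.lookup (proj₁ isF′) E∈F′) (∈⇒⊨ E∈F′))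
        C⊆E : C ⊆ᶜ E
        C⊆E x x∈C with proj₁ (C≈ x) x∈C
        ... | here refl with coversE w w-leaf
        ...   | inj₁ u∈E = u∈E
        ...   | inj₂ clash with find clash
        ...     | y , y∈ , cy∈E = contradiction (Falsifies-compl fE cy∈E) (fα y (proj₂ (C≈ y) (there y∈)))
        C⊆E x x∈C | there x∈w with falsifiedLeaf (flipTo α x) T
        ...   | w″ , w″-leaf , f″ with coversE w″ w″-leaf
        ...     | inj₁ u∈E with w″ ≟ᵖ w
        ...       | yes refl = contradiction (flipTo-sat α x) (f″ x x∈w)
        ...       | no w″≢w  = contradiction (falsifier-other-u w″-leaf w″≢w) (fE _ u∈E)
        C⊆E x x∈C | there x∈w | w″ , w″-leaf , f″ | inj₂ clash with find clash
        ...       | y , y∈ , cy∈E with y ≟ˡ compl x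
        ...         | yes refl = subst (_∈ E) (compl-involutive x) cy∈E
        ...         | no y≢cx  = contradiction (flipTo-preserves α x (Falsifies-compl fE cy∈E) y≢cx) (f″ y y∈)

    i-cong : ∀ C C′ → C ∈ₛ DF → C′ ∈ₛ DF → C ≈ᶜ C′ → i C ≈ᶜ i C′
    i-cong C C′ C∈D C′∈D C≈C′ =
      subst (i C ≈ᶜ_) (firstFalsified-cong (falsifier-≈ᶜ (C-IsClause C∈D) (C-IsClause C′∈D) C≈C′) F′) ≈ᶜ-refl

    i-injective : ∀ C C′ → C ∈ₛ DF → C′ ∈ₛ DF → i C ≈ᶜ i C′ → C ≈ᶜ C′
    i-injective C C′ C∈D C′∈D iC≈iC′ with Dₛ⇒leaf C∈D | Dₛ⇒leaf C′∈D
    ... | w , w-leaf , C≈ | w′ , w′-leaf , C′≈ with w′ ≟ᵖ w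
    ...   | yes refl = ≈ᶜ-trans C≈ (≈ᶜ-sym C′≈)
    ...   | no w′≢w  = contradiction (falsifier-other-u w-leaf C≈ w′-leaf w′≢w)
                                     (proj₁ (proj₂ (i-spec w-leaf C≈)) _ u′∈iC)
      where
      u′∈iC : pos (uw w′) ∈ i C
      u′∈iC = proj₂ (iC≈iC′ _) (proj₂ (proj₂ (i-spec w′-leaf C′≈)) _ (proj₂ (C′≈ _) (here refl)))

    D-embeds : Σ (Clause → Clause) λ i →
        (∀ C → C ∈ₛ DF → i C ∈ₛ F′ × C ⊆ᶜ i C) ×
        (∀ C C′ → C ∈ₛ DF → C′ ∈ₛ DF → C ≈ᶜ C′ → i C ≈ᶜ i C′) ×
        (∀ C C′ → C ∈ₛ DF → C′ ∈ₛ DF → i C ≈ᶜ i C′ → C ≈ᶜ C′)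
    D-embeds = i , i-∈-⊇ , i-cong , i-injective
      where
      i-∈-⊇ : ∀ C → C ∈ₛ DF → i C ∈ₛ F′ × C ⊆ᶜ i C
      i-∈-⊇ C C∈D = let _ , w-leaf , C≈ = Dₛ⇒leaf C∈D
                        iC∈F′ , _ , C⊆iC = i-spec w-leaf C≈
                    in ∈⇒∈ₛ iC∈F′ , C⊆iC

  restrict-doped : ∀ φ w → φ (uw w) ≡ just false → restrict φ (doped w) ≡ restrict φ (Cw w)
  restrict-doped φ w φu = restrict-drop φ (pos (uw w)) (Cw w) (litFalse-assigned φ (uw w) true φu)

  -- If φ leaves C_w unsatisfied but does not set u_w to false, extending φ by a falsifier of
  -- C_w satisfies D(F), hence φ * D(F).
  module _ (φ : PAssignment) {w} (w-leaf : IsLeaf T w) (ns : NotSatisfiedBy φ (Cw w)) where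

    private
      L : Clause
      L = lit (uw w) false ∷ Cw w
      isL : IsClause L
      isL = IsClause-∷ (Cw-IsClause w) (λ m → uw≢var w-leaf w-leaf m refl)
      β : Assignment
      β = falsifier L
      α : Assignment
      α = extend φ β

      α-falsifies : Falsifies α (Cw w)
      α-falsifies (lit v c) y∈ sy with φ v in φv
      ... | just b rewrite sy = case trans (sym (litTrue-assigned φ v c φv)) (ns _ y∈) of
                                  λ e → contradiction (trans (cong not (sym (Bool.xor-same c))) e) λ ()
      ... | nothing = Bool.not-¬ refl (sym (trans (sym (falsifier-value L (lit v c) isL (there y∈))) sy))

    u-true⇒Satisfiable : α (uw w) ≡ true → Satisfiable (φ *ₚ DF)
    u-true⇒Satisfiable u-true = α , SatCS-*ₚ DF (extend-agrees φ β) (satisfies-D w-leaf α-falsifies u-true)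

    Unsat⇒u-false : Unsat (φ *ₚ DF) → φ (uw w) ≡ just false
    Unsat⇒u-false unsat with φ (uw w) in φu
    ... | just false = refl
    ... | just true  = contradiction (u-true⇒Satisfiable (extend-agrees φ β (uw w) true φu)) unsat
    ... | nothing    = contradiction (u-true⇒Satisfiable (trans (extend-unassigned φ β (uw w) φu)
                          (falsifier-value L (lit (uw w) false) isL (here refl)))) unsat

  refutation≤hts : ∀ φ → (∀ w → IsLeaf T w → NotSatisfiedBy φ (Cw w) → φ (uw w) ≡ just false) →
    Σ (Res (φ *ₚ DF) []) λ d → htsR d ≤ hts T
  refutation≤hts φ u-false = treeDerivation φ (φ *ₚ DF) T inj [] (λ _ ()) (λ _ ()) leafClause
    where
    leafClause : ∀ w → IsLeaf T w → NotSatisfiedBy φ (Cw w) → ([] ++ restrict φ (Cw w)) ∈ₛ (φ *ₚ DF)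
    leafClause w w-leaf ns with find (doped∈D w-leaf)
    ... | K , K∈D , doped≈K = lose (∈-*ₚ⁺ {φ} DF K∈D nsK) (≈ᶜ-trans restricted (restrict-≈ᶜ {φ} doped≈K))
      where
      φu = u-false w w-leaf ns
      nsK : NotSatisfiedBy φ K
      nsK y y∈K with proj₂ (doped≈K y) y∈K
      ... | here refl = litTrue-assigned φ (uw w) true φu
      ... | there m   = ns y m
      restricted : restrict φ (Cw w) ≈ᶜ restrict φ (doped w)
      restricted = subst (restrict φ (Cw w) ≈ᶜ_) (sym (restrict-doped φ w φu)) ≈ᶜ-refl

  φ₀ : PAssignment
  φ₀ n = if does (n ∈ⁿ? vars F) then nothing else just false

  φ₀-u : ∀ {w} → IsLeaf T w → φ₀ (uw w) ≡ just false
  φ₀-u {w} w-leaf with uw w ∈ⁿ? vars F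
  ... | yes u∈ = contradiction u∈ (uw∉vars w-leaf)
  ... | no _   = refl

  φ₀-Cw : ∀ {w y} → IsLeaf T w → y ∈ Cw w → φ₀ (var y) ≡ nothing
  φ₀-Cw {w} {y} w-leaf y∈ with var y ∈ⁿ? vars F
  ... | yes _  = refl
  ... | no y∉  = contradiction (Cw-var∈vars w-leaf y∈) y∉

  φ₀*D-leaves : ∀ E → E ∈ φ₀ *ₚ DF → Σ Path λ w → IsLeaf T w × E ≈ᶜ Cw w
  φ₀*D-leaves E E∈ with ∈-*ₚ⁻ {φ₀} DF E∈
  ... | K , K∈D , refl with D⇒leaf K∈D
  ...   | w , w-leaf , K≈ = w , w-leaf , subst (restrict φ₀ K ≈ᶜ_) restricted (restrict-≈ᶜ {φ₀} K≈)
    where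
    restricted : restrict φ₀ (doped w) ≡ Cw w
    restricted = trans (restrict-doped φ₀ w (φ₀-u w-leaf))
                       (restrict-unassigned φ₀ (Cw w) λ y → φ₀-Cw w-leaf)

  refutation-φ₀ : ∀ {C} (d : Res (φ₀ *ₚ DF) C) → EmptyClause C → hts T ≤ htsR d
  refutation-φ₀ d empty = subst (_≤ htsR d) (htsUnder-unassigned T)
    (htsUnder≤htsR T inj _ φ₀*D-leaves d (λ _ → nothing) λ y y∈ → contradiction y∈ (empty y))

  D-hardness : Hd DF (hts T)
  D-hardness = inj₂ (inj₂ (D≢[] , satisfiable , (φ₀ , unsat₀ , hd₀) , maximal))
    where
    satisfiable : Satisfiable DF
    satisfiable = (λ _ → true) , All.tabulate λ E∈D →
      let _ , _ , E≈ = D⇒leaf E∈D in SatClause-≈ᶜ (≈ᶜ-sym E≈) (here refl)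
    d₀ = refutation≤hts φ₀ (λ w w-leaf _ → φ₀-u w-leaf)
    unsat₀ : Unsat (φ₀ *ₚ DF)
    unsat₀ = refutation⇒Unsat (proj₁ d₀) λ _ ()
    hd₀ : HdUnsat (φ₀ *ₚ DF) (hts T)
    hd₀ = ([] , proj₁ d₀ , (λ _ ()) , ℕ.≤-antisym (proj₂ d₀) (refutation-φ₀ (proj₁ d₀) λ _ ()))
        , λ C d → refutation-φ₀ d
    maximal : ∀ φ k → Unsat (φ *ₚ DF) → HdUnsat (φ *ₚ DF) k → k ≤ hts T
    maximal φ _ unsat (_ , minimal) =
      let d , d≤ = refutation≤hts φ (λ w w-leaf ns → Unsat⇒u-false φ w-leaf ns unsat)
      in ℕ.≤-trans (minimal [] d λ _ ()) d≤

theorem5p22 : (F : ClauseList) (T : Tree) (u : Clause → ℕ) →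
    SMU1 F → TreeRep T F → Doping F u →
    ((F′ : ClauseList) → IsClauseSet F′ → Equivalent (D F u) F′ →
      Σ (Clause → Clause) (λ i →
        (∀ C → C ∈ₛ D F u → i C ∈ₛ F′ × C ⊆ᶜ i C) ×
        (∀ C C′ → C ∈ₛ D F u → C′ ∈ₛ D F u → C ≈ᶜ C′ → i C ≈ᶜ i C′) ×
        (∀ C C′ → C ∈ₛ D F u → C′ ∈ₛ D F u → i C ≈ᶜ i C′ → C ≈ᶜ C′))) ×
    TotalMps (D F u) ×
    (∀ C → PrimeImp (D F u) C ⇔′
       Σ (List Path) (λ V → LeafSubset T V × (∀ x → (x ∈ᶜ C) ⇔′ InCV T u V x))) ×
    (∀ V → LeafSubset T V →
       (∀ x → InCV T u V x ⇔′ (InUV T u V x ⊎ InPV T V x)) ×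
       (∀ x → InUV T u V x → ¬ InPV T V x)) ×
    Hd (D F u) (hts T)
theorem5p22 F T u _ tr dop =
  Injection.D-embeds , D-totalMps , prime⇔CV , (λ V → CV-partition) , D-hardness
  where open Doped F T u tr dop
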